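{- Let $V_1,\dots,V_r$ be finite-dimensional vector spaces over a finite field. Then $$Z(\mathcal{B}(V_1,\dots,V_r),u)=\prod_{i=1}^rZ(\mathcal{B}(V_i),u)\times\prod_{1\le i<j\le r}Z_c(X_0(V_i)\times X_0(V_j),u^2).$$
   Context: $\mathcal{B}(V)$ has vertices $x_W$ ($W$ a nonzero proper subspace of $V$) and simplices the flags; opposite vertices $x_W,x_{W'}$ in $\mathcal{B}(V)$ means $V=W\oplus W'$. $\mathcal{B}(V_1,\dots,V_r)$ is the join $\mathcal{B}(V_1)*\cdots*\mathcal{B}(V_r)$ (disjoint union of vertex sets, simplices are unions of one simplex from each factor), in which two vertices are opposite iff they lie in the same $\mathcal{B}(V_i)$ and are opposite there. The link of a vertex $x$ is the subcomplex of simplices $A\not\ni x$ with $A\cup\{x\}$ a simplex; the link of $x_W$, $W\subseteq V_i$, is identified with the join of the $\mathcal{B}(V_j)$, $j\ne i$, with $\mathcal{B}(W)$ and $\mathcal{B}(V_i/W)$, with opposition as in a join. A path is a sequence of vertices with consecutive ones distinct and forming a simplex; it is geodesic if $x_{i-1},x_{i+1}$ are opposite in the link of $x_i$ for each interior $i$. A geodesic cycle of length $l$ is $(x_0,\dots,x_l)$ with $x_l=x_0$ and $(x_0,\dots,x_l,x_1)$ geodesic; $Z(\mathcal{B},u)=\exp(\sum_lN(l)u^l/l)$ with $N(l)$ the number of geodesic cycles of length $l$. $X_0(V)$ is the undirected graph (both edge directions) on the nonzero proper subspaces of $V$ with $x_{W_1}\sim x_{W_2}$ iff $W_1\oplus W_2=V$.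 The tensor product $X\times Y$ of digraphs has vertex set the Cartesian product and an edge $(x_1,y_1)\to(x_2,y_2)$ iff $x_1\to x_2$ and $y_1\to y_2$. $Z_c(X,u)=\exp(\sum_lN_c(X,l)u^l/l)$ with $N_c(X,l)$ the number of closed walks of length $l$. -}

module Defs where

open import Data.Nat as ℕ using (ℕ; zero; suc)
open import Data.Fin using (Fin) renaming (_≟_ to _≟F_)
open import Data.Bool using (Bool; true; false; _∧_; _∨_; not; if_then_else_)
open import Data.List using (List; []; _∷_; allFin; _++_; map; concatMap; filter; length; foldr)
open import Data.Bool.ListAction using (all; any)
open import Data.Vec as Vec using (Vec; []; _∷_; zipWith; replicate; lookup)
open import Data.Vec.Properties using (≡-dec)
open import Data.Product using (Σ; ∃; _×_; _,_)
open import Data.Sum using (_⊎_; inj₁; inj₂)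
open import Data.Empty using (⊥)
open import Data.Integer using (+_)
open import Data.Rational as ℚ using (ℚ; 0ℚ; 1ℚ)
open import Relation.Nullary using (¬_)
open import Relation.Nullary.Decidable using (⌊_⌋)
open import Relation.Binary.PropositionalEquality using (_≡_)
open import Algebra.Structures using (IsCommutativeRing)

-- Finite fields.  A finite field with q elements is presented with
-- carrier  Fin q  (every finite field is in bijection with some Fin q,
-- and the structure can be transported along it).

record FiniteField : Set where
  field
    q     : ℕ
    _+_   : Fin q → Fin q → Fin q
    _*_   : Fin q → Fin q → Fin q
    -_    : Fin q → Fin q
    0#    : Fin q
    1#    : Fin q
    isCommutativeRing : IsCommutativeRing _≡_ _+_ _*_ -_ 0# 1#
    0≢1   : ¬ (0# ≡ 1#)
    inverse : ∀ x → ¬ (x ≡ 0#) → ∃ λ y → x * y ≡ 1#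

vecsOf : {A : Set} → List A → (k : ℕ) → List (Vec A k)
vecsOf xs zero    = [] ∷ []
vecsOf xs (suc k) = concatMap (λ a → map (a ∷_) (vecsOf xs k)) xs

listsOf : {A : Set} → List A → ℕ → List (List A)
listsOf xs zero    = [] ∷ []
listsOf xs (suc k) = concatMap (λ a → map (a ∷_) (listsOf xs k)) xs

count : {A : Set} → (A → Bool) → List A → ℕ
count p xs = length (Data.List.filter (λ x → Data.Bool.T? (p x)) xs)

allPairs : {A : Set} → (A → A → Bool) → List A → Bool
allPairs r (x ∷ y ∷ xs) = r x y ∧ allPairs r (y ∷ xs)
allPairs r _            = true

allTriples : {A : Set} → (A → A → A → Bool) → List A → Bool
allTriples r (x ∷ y ∷ z ∷ xs) = r x y z ∧ allTriples r (y ∷ z ∷ xs)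
allTriples r _                = true

Series : Set
Series = ℕ → ℚ

sumTo : (ℕ → ℚ) → ℕ → ℚ
sumTo f zero    = f 0
sumTo f (suc n) = sumTo f n ℚ.+ f (suc n)

oneS : Series
oneS zero    = 1ℚ
oneS (suc n) = 0ℚ

_*S_ : Series → Series → Series
(f *S g) n = sumTo (λ k → f k ℚ.* g (n ℕ.∸ k)) n

powS : Series → ℕ → Series
powS g zero    = oneS
powS g (suc m) = g *S powS g m

prodS : List Series → Series
prodS = foldr _*S_ oneS

invFact : ℕ → ℚ
invFact zero    = 1ℚ
invFact (suc m) = invFact m ℚ.* ((+ 1) ℚ./ suc m)

-- exp g = Σ_m g^m / m!  (used only for series with g 0 = 0, so the
-- coefficient of u^n only receives contributions from m ≤ n)
expS : Series → Series
expS g n = sumTo (λ m → powS g m n ℚ.* invFact m) n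

-- f(u) ↦ f(u²)
sqS : Series → Series
sqS f zero          = f zero
sqS f (suc zero)    = 0ℚ
sqS f (suc (suc n)) = sqS (λ k → f (suc k)) n

zetaFrom : (ℕ → ℕ) → Series
zetaFrom N = expS logS
  where
  logS : Series
  logS zero    = 0ℚ
  logS (suc l) = (+ N (suc l)) ℚ./ suc l

module _ (F : FiniteField) where
  open FiniteField F

  Vect : ℕ → Set
  Vect n = Vec (Fin q) n

  allVects : (n : ℕ) → List (Vect n)
  allVects n = vecsOf (allFin q) n

  _==v_ : {n : ℕ} → Vect n → Vect n → Bool
  u ==v v = ⌊ ≡-dec _≟F_ u v ⌋

  zeroV : (n : ℕ) → Vect n
  zeroV n = replicate n 0#

  _+v_ : {n : ℕ} → Vect n → Vect n → Vect n
  _+v_ = zipWith _+_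

  _·v_ : {n : ℕ} → Fin q → Vect n → Vect n
  a ·v v = Vec.map (a *_) v

  -- A table of a subset of F^n (canonical: decidable ≡, finitely many)
  Tab : ℕ → Set
  Tab zero    = Bool
  Tab (suc n) = Vec (Tab n) q

  mem : {n : ℕ} → Tab n → Vect n → Bool
  mem {zero}  b []       = b
  mem {suc n} t (a ∷ v)  = mem (lookup t a) v

  allTabs : (n : ℕ) → List (Tab n)
  allTabs zero    = true ∷ false ∷ []
  allTabs (suc n) = vecsOf (allTabs n) q

  Mem : ℕ → Set
  Mem n = Vect n → Bool

  forallV : (n : ℕ) → (Vect n → Bool) → Bool
  forallV n p = all p (allVects n)

  existsV : (n : ℕ) → (Vect n → Bool) → Bool
  existsV n p = any p (allVects n)

  isSubspace : (n : ℕ) → Mem n → Bool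
  isSubspace n W =
    W (zeroV n)
    ∧ forallV n (λ v → forallV n (λ w → not (W v ∧ W w) ∨ W (v +v w)))
    ∧ all (λ a → forallV n (λ v → not (W v) ∨ W (a ·v v))) (allFin q)

  zeroSp : (n : ℕ) → Mem n
  zeroSp n v = v ==v zeroV n

  fullSp : (n : ℕ) → Mem n
  fullSp n v = true

  _⊆?_ : {n : ℕ} → Mem n → Mem n → Bool
  _⊆?_ {n} A B = forallV n (λ v → not (A v) ∨ B v)

  _≐_ : {n : ℕ} → Mem n → Mem n → Bool
  A ≐ B = (A ⊆? B) ∧ (B ⊆? A)

  _∩_ : {n : ℕ} → Mem n → Mem n → Mem n
  (A ∩ B) v = A v ∧ B v

  _⊕+_ : {n : ℕ} → Mem n → Mem n → Mem n
  _⊕+_ {n} A B v = existsV n (λ a → existsV n (λ b → A a ∧ B b ∧ ((a +v b) ==v v)))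

  -- For U = 0, U' = V this is V = A ⊕ B;
  -- for U = 0, U' = W it is opposition in B(W); for U = W, U' = V it is
  -- opposition of A/W, B/W in B(V/W).
  oppIn : {n : ℕ} → Mem n → Mem n → Mem n → Mem n → Bool
  oppIn U U' A B = ((A ∩ B) ≐ U) ∧ ((A ⊕+ B) ≐ U')

  isVertexB : (n : ℕ) → Tab n → Bool
  isVertexB n W = isSubspace n (mem W) ∧ not (mem W ≐ zeroSp n) ∧ not (mem W ≐ fullSp n)

  vertsB : (n : ℕ) → List (Tab n)
  vertsB n = filter (λ W → Data.Bool.T? (isVertexB n W)) (allTabs n)

  -- The join B(V_1, …, V_r), with V_i = F^(n_i) for ns = n_1 ∷ … ∷ n_r

  Vtx : List ℕ → Set
  Vtx []       = ⊥
  Vtx (n ∷ ns) = Tab n ⊎ Vtx ns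

  verts : (ns : List ℕ) → List (Vtx ns)
  verts []       = []
  verts (n ∷ ns) = map inj₁ (vertsB n) ++ map inj₂ (verts ns)

  eqVtx : {ns : List ℕ} → Vtx ns → Vtx ns → Bool
  eqVtx {n ∷ ns} (inj₁ a) (inj₁ b) = mem a ≐ mem b
  eqVtx {n ∷ ns} (inj₂ a) (inj₂ b) = eqVtx a b
  eqVtx {n ∷ ns} _        _        = false

  -- {x, y} is a simplex (an edge): same factor and comparable (a flag),
  -- or different factors (join)
  simplex2 : {ns : List ℕ} → Vtx ns → Vtx ns → Bool
  simplex2 {n ∷ ns} (inj₁ a) (inj₁ b) = (mem a ⊆? mem b) ∨ (mem b ⊆? mem a)
  simplex2 {n ∷ ns} (inj₂ a) (inj₂ b) = simplex2 a b
  simplex2 {n ∷ ns} _        _        = true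

  pathStep : {ns : List ℕ} → Vtx ns → Vtx ns → Bool
  pathStep x y = not (eqVtx x y) ∧ simplex2 x y

  oppJ : {ns : List ℕ} → Vtx ns → Vtx ns → Bool
  oppJ {n ∷ ns} (inj₁ a) (inj₁ b) = oppIn (zeroSp n) (fullSp n) (mem a) (mem b)
  oppJ {n ∷ ns} (inj₂ a) (inj₂ b) = oppJ a b
  oppJ {n ∷ ns} _        _        = false

  -- x and z opposite in the link of y, the link of x_W (W ⊆ V_i) being the
  -- join of the B(V_j) (j ≠ i), B(W) and B(V_i / W)
  oppLink : {ns : List ℕ} → Vtx ns → Vtx ns → Vtx ns → Bool
  oppLink {n ∷ ns} (inj₁ a) (inj₁ w) (inj₁ b) =
      ((mem a ⊆? mem w) ∧ (mem b ⊆? mem w) ∧ oppIn (zeroSp n) (mem w) (mem a) (mem b))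
    ∨ ((mem w ⊆? mem a) ∧ (mem w ⊆? mem b) ∧ oppIn (mem w) (fullSp n) (mem a) (mem b))
  oppLink {n ∷ ns} (inj₂ a) (inj₁ w) (inj₂ b) = oppJ a b
  oppLink {n ∷ ns} (inj₁ a) (inj₂ w) (inj₁ b) = oppIn (zeroSp n) (fullSp n) (mem a) (mem b)
  oppLink {n ∷ ns} (inj₂ a) (inj₂ w) (inj₂ b) = oppLink a w b
  oppLink {n ∷ ns} _        _        _        = false

  isGeodesic : {ns : List ℕ} → List (Vtx ns) → Bool
  isGeodesic xs = allPairs pathStep xs ∧ allTriples oppLink xs

  -- (x_0, …, x_{l-1})  ↦  (x_0, …, x_{l-1}, x_l = x_0, x_1)
  cycleExt : {A : Set} → List A → List A
  cycleExt []       = []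
  cycleExt (x ∷ xs) = x ∷ xs ++ x ∷ second xs
    where
    second : _ → List _
    second []      = x ∷ []
    second (y ∷ _) = y ∷ []

  -- N(l): number of geodesic cycles (x_0, …, x_l) of length l; such a
  -- cycle is determined by (x_0, …, x_{l-1}) since x_l = x_0
  Ngeo : (ns : List ℕ) → ℕ → ℕ
  Ngeo ns l = count (λ s → isGeodesic (cycleExt s)) (listsOf (verts ns) l)

  ZB : List ℕ → Series
  ZB ns = zetaFrom (Ngeo ns)

  record Digraph : Set₁ where
    field
      V     : Set
      vs    : List V
      edge  : V → V → Bool

  X0 : ℕ → Digraph
  X0 n = record { V = Tab n ; vs = vertsB n
                ; edge = λ a b → oppIn (zeroSp n) (fullSp n) (mem a) (mem b) }

  _⊗_ : Digraph → Digraph → Digraph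
  G ⊗ H = record
    { V    = Digraph.V G × Digraph.V H
    ; vs   = concatMap (λ x → map (x ,_) (Digraph.vs H)) (Digraph.vs G)
    ; edge = λ { (x₁ , y₁) (x₂ , y₂) → Digraph.edge G x₁ x₂ ∧ Digraph.edge H y₁ y₂ } }

  closeUp : {A : Set} → List A → List A
  closeUp []       = []
  closeUp (x ∷ xs) = x ∷ xs ++ x ∷ []

  Nc : Digraph → ℕ → ℕ
  Nc G l = count (λ s → allPairs (Digraph.edge G) (closeUp s)) (listsOf (Digraph.vs G) l)

  Zc : Digraph → Series
  Zc G = zetaFrom (Nc G)

pairsLT : List ℕ → List (ℕ × ℕ)
pairsLT []       = []
pairsLT (n ∷ ns) = map (n ,_) ns ++ pairsLT ns

module Submission where

open import Defs
open import Function using (_∘_)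
open import Data.Nat using (ℕ)
open import Data.List using (List; []; _∷_; _++_; map)
import Data.List.Properties as Listₚ
open import Data.Product using (_,_)
open import Relation.Binary.PropositionalEquality using (_≡_; refl; sym; trans; cong; module ≡-Reasoning)

-- For a counting sequence N let Z_N = exp (Σ_{l ≥ 1} N(l) uˡ / l). With θ = u d/du, Z_N is the unique
-- series with constant term 1 and θ Z_N = (Σ_{l ≥ 1} N(l) uˡ) Z_N; by Leibniz' rule this makes
-- Z_{N+M} = Z_N Z_M, and Z_N(u²) = Z_{N'} where N'(2m) = 2 N(m) and N'(2m+1) = 0. So it suffices to
-- count geodesic cycles. In the link of a vertex of B(Vᵢ) a vertex of another factor is opposite only
-- to vertices of its own factor, so along a geodesic cycle the factor repeats with period two: the
-- cycle lies in one B(Vᵢ), or it alternates between Vᵢ and the remaining factors. A cycle of the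
-- second kind of length 2m is a closed walk of length m in X₀(Vᵢ) × (opposition graph of the rest),
-- started in either of the two factors, and that opposition graph is the disjoint union of the
-- X₀(Vⱼ), j > i.

module PowerSeries where

  open import Data.Product using (∃-syntax)
  open import Data.Sum using (_⊎_; inj₁; inj₂)
  open import Data.Nat as ℕ using (zero; suc; _≤_; _<_; z≤n; s≤s)
  import Data.Nat.Properties as ℕₚ
  open import Algebra.Properties.CommutativeSemigroup ℕₚ.+-commutativeSemigroup using () renaming (interchange to +-interchange)
  open import Data.Integer as ℤ using (+_)
  import Data.Integer.Properties as ℤₚ
  import Data.Integer.Solver as ℤ-Solver
  open import Data.Rational using (ℚ; 0ℚ; 1ℚ; _+_; _*_; _/_; toℚᵘ)
  import Data.Rational.Properties as ℚₚ
  import Data.Rational.Solver as ℚ-Solver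
  open import Data.Rational.Unnormalised using (mkℚᵘ; *≡*) renaming (_≃_ to _≃ᵘ_)
  import Data.Rational.Unnormalised.Properties as ℚᵘₚ
  open import Relation.Binary.PropositionalEquality
  open ≡-Reasoning

  fromℕ : ℕ → ℚ
  fromℕ n = + n / 1

  private
    toℚᵘ-/ : ∀ i a → toℚᵘ (i / suc a) ≃ᵘ mkℚᵘ i a
    toℚᵘ-/ i a = ℚₚ.toℚᵘ-fromℚᵘ (mkℚᵘ i a)

  fromℕ-+ : ∀ m n → fromℕ (m ℕ.+ n) ≡ fromℕ m + fromℕ n
  fromℕ-+ m n = ℚₚ.toℚᵘ-injective (ℚᵘₚ.≃-trans (toℚᵘ-/ (+ (m ℕ.+ n)) 0) (ℚᵘₚ.≃-sym
    (ℚᵘₚ.≃-trans (ℚₚ.toℚᵘ-homo-+ (fromℕ m) (fromℕ n)) (ℚᵘₚ.≃-trans (ℚᵘₚ.+-cong (toℚᵘ-/ (+ m) 0) (toℚᵘ-/ (+ n) 0)) (*≡* eq)))))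
    where
    open ℤ-Solver.+-*-Solver
    eq : (+ m ℤ.* + 1 ℤ.+ + n ℤ.* + 1) ℤ.* + 1 ≡ + (m ℕ.+ n) ℤ.* + 1
    eq rewrite ℤₚ.pos-+ m n = solve 2 (λ x y → (x :* con (+ 1) :+ y :* con (+ 1)) :* con (+ 1) := (x :+ y) :* con (+ 1)) refl (+ m) (+ n)

  fromℕ-suc : ∀ n → fromℕ (suc n) ≡ fromℕ n + 1ℚ
  fromℕ-suc n = trans (cong fromℕ (ℕₚ.+-comm 1 n)) (fromℕ-+ n 1)

  fromℕ-suc-*-/ : ∀ n k → fromℕ (suc n) * (+ k / suc n) ≡ fromℕ k
  fromℕ-suc-*-/ n k = ℚₚ.toℚᵘ-injective (ℚᵘₚ.≃-trans (ℚₚ.toℚᵘ-homo-* (fromℕ (suc n)) (+ k / suc n))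
    (ℚᵘₚ.≃-trans (ℚᵘₚ.*-cong (toℚᵘ-/ (+ suc n) 0) (toℚᵘ-/ (+ k) n)) (ℚᵘₚ.≃-trans (*≡* eq) (ℚᵘₚ.≃-sym (toℚᵘ-/ (+ k) 0)))))
    where
    open ℤ-Solver.+-*-Solver
    eq : (+ suc n ℤ.* + k) ℤ.* + 1 ≡ + k ℤ.* + (1 ℕ.* suc n)
    eq rewrite ℕₚ.*-identityˡ (suc n) = solve 2 (λ x y → (x :* y) :* con (+ 1) := y :* x) refl (+ suc n) (+ k)

  fromℕ-suc-cancelˡ : ∀ n {x y} → fromℕ (suc n) * x ≡ fromℕ (suc n) * y → x ≡ y
  fromℕ-suc-cancelˡ n {x} {y} eq = begin
    x                   ≡⟨ sym (ℚₚ.*-identityˡ x) ⟩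
    1ℚ * x              ≡⟨ cong (_* x) (sym inverse) ⟩
    r * fromℕ (suc n) * x   ≡⟨ ℚₚ.*-assoc r _ x ⟩
    r * (fromℕ (suc n) * x) ≡⟨ cong (r *_) eq ⟩
    r * (fromℕ (suc n) * y) ≡⟨ sym (ℚₚ.*-assoc r _ y) ⟩
    r * fromℕ (suc n) * y   ≡⟨ cong (_* y) inverse ⟩
    1ℚ * y              ≡⟨ ℚₚ.*-identityˡ y ⟩
    y                   ∎
    where
    r = + 1 / suc n
    inverse : r * fromℕ (suc n) ≡ 1ℚ
    inverse = trans (ℚₚ.*-comm r _) (fromℕ-suc-*-/ n 1)

  infixl 6 _+S_
  infixr 7 _·S_

  _+S_ : Series → Series → Series
  (f +S g) n = f n + g n

  _·S_ : ℚ → Series → Series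
  (c ·S f) n = c * f n

  zeroS : Series
  zeroS _ = 0ℚ

  sumTo-cong : ∀ {h h'} n → (∀ k → h k ≡ h' k) → sumTo h n ≡ sumTo h' n
  sumTo-cong zero    e = e 0
  sumTo-cong (suc n) e = cong₂ _+_ (sumTo-cong n e) (e (suc n))

  sumTo-suc : ∀ h n → sumTo h (suc n) ≡ h 0 + sumTo (h ∘ suc) n
  sumTo-suc h zero    = refl
  sumTo-suc h (suc n) = trans (cong (_+ h (suc (suc n))) (sumTo-suc h n)) (ℚₚ.+-assoc (h 0) _ _)

  sumTo-*ˡ : ∀ c h n → c * sumTo h n ≡ sumTo (λ k → c * h k) n
  sumTo-*ˡ c h zero    = refl
  sumTo-*ˡ c h (suc n) = trans (ℚₚ.*-distribˡ-+ c (sumTo h n) (h (suc n))) (cong (_+ c * h (suc n)) (sumTo-*ˡ c h n))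

  sumTo-zero : ∀ {h} n → (∀ k → h k ≡ 0ℚ) → sumTo h n ≡ 0ℚ
  sumTo-zero zero    e = e 0
  sumTo-zero (suc n) e = cong₂ _+_ (sumTo-zero n e) (e (suc n))

  sumTo-extend : ∀ {h} k N → k ≤ N → (∀ m → k < m → h m ≡ 0ℚ) → sumTo h k ≡ sumTo h N
  sumTo-extend {h} k N k≤N e with ℕₚ.m≤n⇒∃[o]m+o≡n k≤N
  ... | d , refl = go d
    where
    go : ∀ d → sumTo h k ≡ sumTo h (k ℕ.+ d)
    go zero    = cong (sumTo h) (sym (ℕₚ.+-identityʳ k))
    go (suc d) = begin
      sumTo h k                          ≡⟨ go d ⟩
      sumTo h (k ℕ.+ d)                  ≡⟨ sym (ℚₚ.+-identityʳ _) ⟩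
      sumTo h (k ℕ.+ d) + 0ℚ             ≡⟨ cong (λ z → sumTo h (k ℕ.+ d) + z) (sym (e _ (s≤s (ℕₚ.m≤m+n k d)))) ⟩
      sumTo h (suc (k ℕ.+ d))            ≡⟨ cong (sumTo h) (sym (ℕₚ.+-suc k d)) ⟩
      sumTo h (k ℕ.+ suc d)              ∎

  *S-suc : ∀ f g n → (f *S g) (suc n) ≡ f 0 * g (suc n) + ((f ∘ suc) *S g) n
  *S-suc f g n = sumTo-suc _ n

  *S-sucʳ : ∀ f g n → (f *S g) (suc n) ≡ (f *S (g ∘ suc)) n + f (suc n) * g 0
  *S-sucʳ f g zero    = refl
  *S-sucʳ f g (suc n) = begin
    (f *S g) (suc (suc n))                                         ≡⟨ *S-suc f g (suc n) ⟩
    f 0 * g (suc (suc n)) + ((f ∘ suc) *S g) (suc n)               ≡⟨ cong (λ z → f 0 * g (suc (suc n)) + z) (*S-sucʳ (f ∘ suc) g n) ⟩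
    f 0 * g (suc (suc n)) + (((f ∘ suc) *S (g ∘ suc)) n + f (suc (suc n)) * g 0) ≡⟨ sym (ℚₚ.+-assoc (f 0 * g (suc (suc n))) _ _) ⟩
    f 0 * g (suc (suc n)) + ((f ∘ suc) *S (g ∘ suc)) n + f (suc (suc n)) * g 0   ≡⟨ cong (_+ f (suc (suc n)) * g 0) (sym (*S-suc f (g ∘ suc) n)) ⟩
    (f *S (g ∘ suc)) (suc n) + f (suc (suc n)) * g 0               ∎

  *S-cong : ∀ {f f' g g'} → f ≗ f' → g ≗ g' → f *S g ≗ f' *S g'
  *S-cong ef eg n = sumTo-cong n (λ k → cong₂ _*_ (ef k) (eg (n ℕ.∸ k)))

  *S-congˡ : ∀ {f f'} g → f ≗ f' → f *S g ≗ f' *S g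
  *S-congˡ g ef = *S-cong {g = g} {g' = g} ef (λ _ → refl)

  *S-congʳ : ∀ f {g g'} → g ≗ g' → f *S g ≗ f *S g'
  *S-congʳ f eg = *S-cong {f = f} {f' = f} (λ _ → refl) eg

  *S-suc-vanishing : ∀ f g n → f 0 ≡ 0ℚ → (f *S g) (suc n) ≡ ((f ∘ suc) *S g) n
  *S-suc-vanishing f g n f0 = begin
    (f *S g) (suc n)                       ≡⟨ *S-suc f g n ⟩
    f 0 * g (suc n) + ((f ∘ suc) *S g) n   ≡⟨ cong (λ z → z * g (suc n) + ((f ∘ suc) *S g) n) f0 ⟩
    0ℚ * g (suc n) + ((f ∘ suc) *S g) n    ≡⟨ cong (_+ ((f ∘ suc) *S g) n) (ℚₚ.*-zeroˡ (g (suc n))) ⟩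
    0ℚ + ((f ∘ suc) *S g) n                ≡⟨ ℚₚ.+-identityˡ _ ⟩
    ((f ∘ suc) *S g) n                     ∎

  *S-local : ∀ f g g' n → f 0 ≡ 0ℚ → (∀ k → k ≤ n → g k ≡ g' k) → (f *S g) (suc n) ≡ (f *S g') (suc n)
  *S-local f g g' n f0 e = begin
    (f *S g) (suc n)     ≡⟨ *S-suc-vanishing f g n f0 ⟩
    ((f ∘ suc) *S g) n   ≡⟨ sumTo-cong n (λ k → cong (f (suc k) *_) (e (n ℕ.∸ k) (ℕₚ.m∸n≤m n k))) ⟩
    ((f ∘ suc) *S g') n  ≡⟨ sym (*S-suc-vanishing f g' n f0) ⟩
    (f *S g') (suc n)    ∎

  *S-distribʳ : ∀ f g h → (f +S g) *S h ≗ f *S h +S g *S h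
  *S-distribʳ f g h zero    = ℚₚ.*-distribʳ-+ (h 0) (f 0) (g 0)
  *S-distribʳ f g h (suc n) = begin
    ((f +S g) *S h) (suc n)                                         ≡⟨ *S-suc (f +S g) h n ⟩
    (f 0 + g 0) * h (suc n) + (((f ∘ suc) +S (g ∘ suc)) *S h) n     ≡⟨ cong (λ z → (f 0 + g 0) * h (suc n) + z) (*S-distribʳ (f ∘ suc) (g ∘ suc) h n) ⟩
    (f 0 + g 0) * h (suc n) + (((f ∘ suc) *S h) n + ((g ∘ suc) *S h) n)
      ≡⟨ solve 5 (λ a b c d e → (a :+ b) :* c :+ (d :+ e) := (a :* c :+ d) :+ (b :* c :+ e)) refl (f 0) (g 0) (h (suc n)) _ _ ⟩
    (f 0 * h (suc n) + ((f ∘ suc) *S h) n) + (g 0 * h (suc n) + ((g ∘ suc) *S h) n) ≡⟨ sym (cong₂ _+_ (*S-suc f h n) (*S-suc g h n)) ⟩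
    (f *S h +S g *S h) (suc n)                                      ∎
    where open ℚ-Solver.+-*-Solver

  *S-distribˡ : ∀ f g h → f *S (g +S h) ≗ f *S g +S f *S h
  *S-distribˡ f g h zero    = ℚₚ.*-distribˡ-+ (f 0) (g 0) (h 0)
  *S-distribˡ f g h (suc n) = begin
    (f *S (g +S h)) (suc n)                                         ≡⟨ *S-suc f (g +S h) n ⟩
    f 0 * (g (suc n) + h (suc n)) + ((f ∘ suc) *S (g +S h)) n       ≡⟨ cong (λ z → f 0 * (g (suc n) + h (suc n)) + z) (*S-distribˡ (f ∘ suc) g h n) ⟩
    f 0 * (g (suc n) + h (suc n)) + (((f ∘ suc) *S g) n + ((f ∘ suc) *S h) n)
      ≡⟨ solve 5 (λ a b c d e → a :* (b :+ c) :+ (d :+ e) := (a :* b :+ d) :+ (a :* c :+ e)) refl (f 0) (g (suc n)) (h (suc n)) _ _ ⟩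
    (f 0 * g (suc n) + ((f ∘ suc) *S g) n) + (f 0 * h (suc n) + ((f ∘ suc) *S h) n) ≡⟨ sym (cong₂ _+_ (*S-suc f g n) (*S-suc f h n)) ⟩
    (f *S g +S f *S h) (suc n)                                      ∎
    where open ℚ-Solver.+-*-Solver

  *S-·ˡ : ∀ c f g → (c ·S f) *S g ≗ c ·S (f *S g)
  *S-·ˡ c f g n = trans (sumTo-cong n (λ k → ℚₚ.*-assoc c (f k) _)) (sym (sumTo-*ˡ c _ n))

  *S-·ʳ : ∀ c f g → f *S (c ·S g) ≗ c ·S (f *S g)
  *S-·ʳ c f g n = trans (sumTo-cong n (λ k → solve 3 (λ a b c → a :* (c :* b) := c :* (a :* b)) refl (f k) (g (n ℕ.∸ k)) c)) (sym (sumTo-*ˡ c _ n))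
    where open ℚ-Solver.+-*-Solver

  *S-zeroˡ : ∀ g → zeroS *S g ≗ zeroS
  *S-zeroˡ g n = sumTo-zero n (λ k → ℚₚ.*-zeroˡ (g (n ℕ.∸ k)))

  *S-identityˡ : ∀ g → oneS *S g ≗ g
  *S-identityˡ g zero    = ℚₚ.*-identityˡ (g 0)
  *S-identityˡ g (suc n) = begin
    (oneS *S g) (suc n)                   ≡⟨ *S-suc oneS g n ⟩
    1ℚ * g (suc n) + (zeroS *S g) n       ≡⟨ cong₂ _+_ (ℚₚ.*-identityˡ (g (suc n))) (*S-zeroˡ g n) ⟩
    g (suc n) + 0ℚ                        ≡⟨ ℚₚ.+-identityʳ _ ⟩
    g (suc n)                             ∎

  *S-comm : ∀ f g → f *S g ≗ g *S f
  *S-comm f g zero    = ℚₚ.*-comm (f 0) (g 0)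
  *S-comm f g (suc n) = begin
    (f *S g) (suc n)                       ≡⟨ *S-suc f g n ⟩
    f 0 * g (suc n) + ((f ∘ suc) *S g) n   ≡⟨ cong (λ z → f 0 * g (suc n) + z) (*S-comm (f ∘ suc) g n) ⟩
    f 0 * g (suc n) + (g *S (f ∘ suc)) n   ≡⟨ solve 3 (λ a b c → a :* b :+ c := c :+ b :* a) refl (f 0) (g (suc n)) _ ⟩
    (g *S (f ∘ suc)) n + g (suc n) * f 0   ≡⟨ sym (*S-sucʳ g f n) ⟩
    (g *S f) (suc n)                       ∎
    where open ℚ-Solver.+-*-Solver

  *S-assoc : ∀ f g h → (f *S g) *S h ≗ f *S (g *S h)
  *S-assoc f g h zero    = ℚₚ.*-assoc (f 0) (g 0) (h 0)
  *S-assoc f g h (suc n) = begin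
    ((f *S g) *S h) (suc n)                                ≡⟨ *S-suc (f *S g) h n ⟩
    f 0 * g 0 * h (suc n) + (((f *S g) ∘ suc) *S h) n      ≡⟨ cong (λ z → f 0 * g 0 * h (suc n) + z) tail ⟩
    f 0 * g 0 * h (suc n) + (f 0 * ((g ∘ suc) *S h) n + ((f ∘ suc) *S (g *S h)) n)
       ≡⟨ solve 5 (λ a b c d e → a :* b :* c :+ (a :* d :+ e) := a :* (b :* c :+ d) :+ e) refl (f 0) (g 0) (h (suc n)) _ _ ⟩
    f 0 * (g 0 * h (suc n) + ((g ∘ suc) *S h) n) + ((f ∘ suc) *S (g *S h)) n ≡⟨ sym (cong (λ z → f 0 * z + ((f ∘ suc) *S (g *S h)) n) (*S-suc g h n)) ⟩
    f 0 * (g *S h) (suc n) + ((f ∘ suc) *S (g *S h)) n     ≡⟨ sym (*S-suc f (g *S h) n) ⟩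
    (f *S (g *S h)) (suc n)                                ∎
    where
    open ℚ-Solver.+-*-Solver
    tail : (((f *S g) ∘ suc) *S h) n ≡ f 0 * ((g ∘ suc) *S h) n + ((f ∘ suc) *S (g *S h)) n
    tail = begin
      (((f *S g) ∘ suc) *S h) n                                     ≡⟨ *S-congˡ h (*S-suc f g) n ⟩
      ((f 0 ·S (g ∘ suc) +S (f ∘ suc) *S g) *S h) n                 ≡⟨ *S-distribʳ (f 0 ·S (g ∘ suc)) ((f ∘ suc) *S g) h n ⟩
      ((f 0 ·S (g ∘ suc)) *S h) n + (((f ∘ suc) *S g) *S h) n       ≡⟨ cong₂ _+_ (*S-·ˡ (f 0) (g ∘ suc) h n) (*S-assoc (f ∘ suc) g h n) ⟩
      f 0 * ((g ∘ suc) *S h) n + ((f ∘ suc) *S (g *S h)) n          ∎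

  θ : Series → Series
  θ f n = fromℕ n * f n

  θ-cong : ∀ {f g} → f ≗ g → θ f ≗ θ g
  θ-cong e n = cong (fromℕ n *_) (e n)

  θ-zero : ∀ f → θ f 0 ≡ 0ℚ
  θ-zero f = ℚₚ.*-zeroˡ (f 0)

  θ-∘suc : ∀ f → θ f ∘ suc ≗ θ (f ∘ suc) +S f ∘ suc
  θ-∘suc f k = begin
    fromℕ (suc k) * f (suc k)               ≡⟨ cong (_* f (suc k)) (fromℕ-suc k) ⟩
    (fromℕ k + 1ℚ) * f (suc k)              ≡⟨ ℚₚ.*-distribʳ-+ (f (suc k)) (fromℕ k) 1ℚ ⟩
    fromℕ k * f (suc k) + 1ℚ * f (suc k)    ≡⟨ cong (λ z → fromℕ k * f (suc k) + z) (ℚₚ.*-identityˡ (f (suc k))) ⟩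
    fromℕ k * f (suc k) + f (suc k)         ∎

  θ-*S : ∀ f g → θ (f *S g) ≗ θ f *S g +S f *S θ g
  θ-*S f g zero    = solve 2 (λ a b → con 0ℚ :* (a :* b) := con 0ℚ :* a :* b :+ a :* (con 0ℚ :* b)) refl (f 0) (g 0)
    where open ℚ-Solver.+-*-Solver
  θ-*S f g (suc n) = begin
    fromℕ (suc n) * (f *S g) (suc n)                      ≡⟨ cong₂ _*_ (fromℕ-suc n) (*S-suc f g n) ⟩
    (N + 1ℚ) * (f 0 * G + T)
      ≡⟨ solve 4 (λ N a G T → (N :+ con 1ℚ) :* (a :* G :+ T) := N :* T :+ T :+ a :* ((N :+ con 1ℚ) :* G)) refl N (f 0) G T ⟩
    N * T + T + f 0 * ((N + 1ℚ) * G)                      ≡⟨ cong₂ (λ u v → u + T + f 0 * (v * G)) (θ-*S (f ∘ suc) g n) (sym (fromℕ-suc n)) ⟩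
    (θ (f ∘ suc) *S g) n + B + T + f 0 * θ g (suc n)
      ≡⟨ solve 4 (λ A B T X → A :+ B :+ T :+ X := (A :+ T) :+ (X :+ B)) refl (((θ (f ∘ suc)) *S g) n) B T (f 0 * θ g (suc n)) ⟩
    ((θ (f ∘ suc) *S g) n + T) + (f 0 * θ g (suc n) + B)  ≡⟨ cong (λ z → z + (f 0 * θ g (suc n) + B)) (sym (*S-distribʳ (θ (f ∘ suc)) (f ∘ suc) g n)) ⟩
    ((θ (f ∘ suc) +S f ∘ suc) *S g) n + (f 0 * θ g (suc n) + B) ≡⟨ cong (λ z → z + (f 0 * θ g (suc n) + B)) (sym (*S-congˡ g (θ-∘suc f) n)) ⟩
    ((θ f ∘ suc) *S g) n + (f 0 * θ g (suc n) + B)        ≡⟨ cong₂ _+_ (sym (*S-suc-vanishing (θ f) g n (θ-zero f))) (sym (*S-suc f (θ g) n)) ⟩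
    (θ f *S g +S f *S θ g) (suc n)                        ∎
    where
    open ℚ-Solver.+-*-Solver
    N = fromℕ n
    G = g (suc n)
    T = ((f ∘ suc) *S g) n
    B = ((f ∘ suc) *S θ g) n

  *S-zeroʳ : ∀ f → f *S zeroS ≗ zeroS
  *S-zeroʳ f n = trans (*S-comm f zeroS n) (*S-zeroˡ f n)

  θ-oneS : θ oneS ≗ zeroS
  θ-oneS zero    = ℚₚ.*-zeroˡ 1ℚ
  θ-oneS (suc n) = ℚₚ.*-zeroʳ (fromℕ (suc n))

  θ-powS : ∀ g m → θ (powS g (suc m)) ≗ fromℕ (suc m) ·S (θ g *S powS g m)
  θ-powS g zero n = begin
    θ (g *S oneS) n                       ≡⟨ θ-*S g oneS n ⟩
    (θ g *S oneS) n + (g *S θ oneS) n     ≡⟨ cong (λ z → (θ g *S oneS) n + z) (trans (*S-congʳ g θ-oneS n) (*S-zeroʳ g n)) ⟩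
    (θ g *S oneS) n + 0ℚ                  ≡⟨ solve 1 (λ x → x :+ con 0ℚ := con 1ℚ :* x) refl ((θ g *S oneS) n) ⟩
    1ℚ * (θ g *S oneS) n                  ∎
    where open ℚ-Solver.+-*-Solver
  θ-powS g (suc m) n = begin
    θ (g *S P) n                          ≡⟨ θ-*S g P n ⟩
    X + (g *S θ P) n                      ≡⟨ cong (λ z → X + z) (*S-congʳ g (θ-powS g m) n) ⟩
    X + (g *S (c ·S (θ g *S Q))) n        ≡⟨ cong (λ z → X + z) (*S-·ʳ c g (θ g *S Q) n) ⟩
    X + c * (g *S (θ g *S Q)) n           ≡⟨ cong (λ z → X + c * z) reorder ⟩
    X + c * X                             ≡⟨ solve 2 (λ X c → X :+ c :* X := (c :+ con 1ℚ) :* X) refl X c ⟩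
    (c + 1ℚ) * X                          ≡⟨ cong (_* X) (sym (fromℕ-suc (suc m))) ⟩
    fromℕ (suc (suc m)) * X               ∎
    where
    open ℚ-Solver.+-*-Solver
    P = powS g (suc m)
    Q = powS g m
    c = fromℕ (suc m)
    X = (θ g *S P) n
    reorder : (g *S (θ g *S Q)) n ≡ X
    reorder = begin
      (g *S (θ g *S Q)) n   ≡⟨ sym (*S-assoc g (θ g) Q n) ⟩
      ((g *S θ g) *S Q) n   ≡⟨ *S-congˡ Q (*S-comm g (θ g)) n ⟩
      ((θ g *S g) *S Q) n   ≡⟨ *S-assoc (θ g) g Q n ⟩
      X                     ∎

  powS-vanishes : ∀ {g} → g 0 ≡ 0ℚ → ∀ m k → k < m → powS g m k ≡ 0ℚ
  powS-vanishes {g} g0 (suc m) zero    _         = trans (cong (_* powS g m 0) g0) (ℚₚ.*-zeroˡ (powS g m 0))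
  powS-vanishes {g} g0 (suc m) (suc k) (s≤s k<m) = trans (*S-suc-vanishing g (powS g m) k g0)
    (sumTo-zero k (λ j → trans (cong (g (suc j) *_) (powS-vanishes g0 m (k ℕ.∸ j) (ℕₚ.≤-<-trans (ℕₚ.m∸n≤m k j) k<m)))
                               (ℚₚ.*-zeroʳ (g (suc j)))))

  expS-truncate : ∀ {g} → g 0 ≡ 0ℚ → ∀ N k → k ≤ N → expS g k ≡ sumTo (λ m → powS g m k * invFact m) N
  expS-truncate g0 N k k≤N = sumTo-extend k N k≤N
    (λ m k<m → trans (cong (_* invFact m) (powS-vanishes g0 m k k<m)) (ℚₚ.*-zeroˡ (invFact m)))

  *S-sumTo : ∀ f (H : ℕ → Series) N n → (f *S (λ k → sumTo (λ m → H m k) N)) n ≡ sumTo (λ m → (f *S H m) n) N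
  *S-sumTo f H zero    n = refl
  *S-sumTo f H (suc N) n = trans (*S-distribˡ f (λ k → sumTo (λ m → H m k) N) (H (suc N)) n) (cong (_+ (f *S H (suc N)) n) (*S-sumTo f H N n))

  θ-expS : ∀ g → g 0 ≡ 0ℚ → θ (expS g) ≗ θ g *S expS g
  θ-expS g g0 zero    = trans (ℚₚ.*-zeroˡ 1ℚ) (sym (trans (cong (_* 1ℚ) (θ-zero g)) (ℚₚ.*-zeroˡ 1ℚ)))
  θ-expS g g0 (suc n) = begin
    fromℕ (suc n) * sumTo term (suc n)                        ≡⟨ sumTo-*ˡ (fromℕ (suc n)) term (suc n) ⟩
    sumTo (λ m → fromℕ (suc n) * term m) (suc n)             ≡⟨ sumTo-suc _ n ⟩
    fromℕ (suc n) * (0ℚ * 1ℚ) + sumTo (λ m → fromℕ (suc n) * term (suc m)) n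
                                                              ≡⟨ cong₂ _+_ (ℚₚ.*-zeroʳ (fromℕ (suc n))) (sumTo-cong n lower) ⟩
    0ℚ + sumTo (λ m → (θ g *S (invFact m ·S powS g m)) (suc n)) n ≡⟨ ℚₚ.+-identityˡ _ ⟩
    sumTo (λ m → (θ g *S (invFact m ·S powS g m)) (suc n)) n  ≡⟨ sym (*S-sumTo (θ g) (λ m → invFact m ·S powS g m) n (suc n)) ⟩
    (θ g *S (λ k → sumTo (λ m → invFact m * powS g m k) n)) (suc n)
                                                              ≡⟨ *S-local (θ g) _ (expS g) n (θ-zero g) truncation ⟩
    (θ g *S expS g) (suc n)                                   ∎
    where
    term : ℕ → ℚ
    term m = powS g m (suc n) * invFact m
    lower : ∀ m → fromℕ (suc n) * term (suc m) ≡ (θ g *S (invFact m ·S powS g m)) (suc n)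
    lower m = begin
      fromℕ (suc n) * (powS g (suc m) (suc n) * (invFact m * r))
        ≡⟨ solve 4 (λ a b c d → a :* (b :* (c :* d)) := (a :* b) :* c :* d) refl (fromℕ (suc n)) _ (invFact m) r ⟩
      θ (powS g (suc m)) (suc n) * invFact m * r                   ≡⟨ cong (λ z → z * invFact m * r) (θ-powS g m (suc n)) ⟩
      fromℕ (suc m) * Y * invFact m * r
        ≡⟨ solve 4 (λ a b c d → a :* b :* c :* d := c :* b :* (a :* d)) refl (fromℕ (suc m)) Y (invFact m) r ⟩
      invFact m * Y * (fromℕ (suc m) * r)                          ≡⟨ cong (λ z → invFact m * Y * z) (fromℕ-suc-*-/ m 1) ⟩
      invFact m * Y * 1ℚ                                           ≡⟨ ℚₚ.*-identityʳ _ ⟩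
      invFact m * Y                                                ≡⟨ sym (*S-·ʳ (invFact m) (θ g) (powS g m) (suc n)) ⟩
      (θ g *S (invFact m ·S powS g m)) (suc n)                     ∎
      where
      open ℚ-Solver.+-*-Solver
      r = + 1 / suc m
      Y = (θ g *S powS g m) (suc n)
    truncation : ∀ k → k ≤ n → sumTo (λ m → invFact m * powS g m k) n ≡ expS g k
    truncation k k≤n = trans (sumTo-cong n (λ m → ℚₚ.*-comm (invFact m) (powS g m k))) (sym (expS-truncate g0 n k k≤n))

  θ-unique : ∀ h {E E'} → h 0 ≡ 0ℚ → E 0 ≡ E' 0 → θ E ≗ h *S E → θ E' ≗ h *S E' → E ≗ E'
  θ-unique h {E} {E'} h0 e0 eE eE' n = agreeUpTo n n ℕₚ.≤-refl
    where
    agreeUpTo : ∀ n k → k ≤ n → E k ≡ E' k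
    agreeUpTo zero    .zero z≤n = e0
    agreeUpTo (suc n) k   k≤1+n with ℕₚ.m≤n⇒m<n∨m≡n k≤1+n
    ... | inj₁ (s≤s k≤n) = agreeUpTo n k k≤n
    ... | inj₂ refl      = fromℕ-suc-cancelˡ n (begin
      θ E (suc n)            ≡⟨ eE (suc n) ⟩
      (h *S E) (suc n)       ≡⟨ *S-local h E E' n h0 (agreeUpTo n) ⟩
      (h *S E') (suc n)      ≡⟨ sym (eE' (suc n)) ⟩
      θ E' (suc n)           ∎)

  powS-cong : ∀ {g g'} → g ≗ g' → ∀ m → powS g m ≗ powS g' m
  powS-cong e zero    n = refl
  powS-cong e (suc m)   = *S-cong e (powS-cong e m)

  expS-cong : ∀ {g g'} → g ≗ g' → expS g ≗ expS g'
  expS-cong e n = sumTo-cong n (λ m → cong (_* invFact m) (powS-cong e m n))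

  logSeries : (ℕ → ℕ) → Series
  logSeries N zero    = 0ℚ
  logSeries N (suc l) = + N (suc l) / suc l

  -- θ log Z for Z = zetaFrom N
  countSeries : (ℕ → ℕ) → Series
  countSeries N zero    = 0ℚ
  countSeries N (suc l) = fromℕ (N (suc l))

  zetaFrom≗expS : ∀ N → zetaFrom N ≗ expS (logSeries N)
  zetaFrom≗expS N = expS-cong (λ { zero → refl ; (suc l) → refl })

  θ-logSeries : ∀ N → θ (logSeries N) ≗ countSeries N
  θ-logSeries N zero    = ℚₚ.*-zeroˡ 0ℚ
  θ-logSeries N (suc l) = fromℕ-suc-*-/ l (N (suc l))

  θ-zetaFrom : ∀ N → θ (zetaFrom N) ≗ countSeries N *S zetaFrom N
  θ-zetaFrom N n = begin
    θ (zetaFrom N) n                           ≡⟨ θ-cong (zetaFrom≗expS N) n ⟩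
    θ (expS (logSeries N)) n                   ≡⟨ θ-expS (logSeries N) refl n ⟩
    (θ (logSeries N) *S expS (logSeries N)) n  ≡⟨ *S-cong (θ-logSeries N) (λ k → sym (zetaFrom≗expS N k)) n ⟩
    (countSeries N *S zetaFrom N) n            ∎

  zetaFrom-unique : ∀ N {E} → E 0 ≡ 1ℚ → θ E ≗ countSeries N *S E → zetaFrom N ≗ E
  zetaFrom-unique N E0 θE = θ-unique (countSeries N) refl (sym E0) (θ-zetaFrom N) θE

  countSeries-cong : ∀ {N M} → (∀ l → N (suc l) ≡ M (suc l)) → countSeries N ≗ countSeries M
  countSeries-cong e zero    = refl
  countSeries-cong e (suc l) = cong fromℕ (e l)

  countSeries-+ : ∀ N M → countSeries (λ l → N l ℕ.+ M l) ≗ countSeries N +S countSeries M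
  countSeries-+ N M zero    = refl
  countSeries-+ N M (suc l) = fromℕ-+ (N (suc l)) (M (suc l))

  zetaFrom-cong : ∀ {N M} → (∀ l → N (suc l) ≡ M (suc l)) → zetaFrom N ≗ zetaFrom M
  zetaFrom-cong {N} {M} e = zetaFrom-unique N refl (λ n → trans (θ-zetaFrom M n) (*S-congˡ (zetaFrom M) (λ k → sym (countSeries-cong e k)) n))

  zetaFrom-zero : zetaFrom (λ _ → 0) ≗ oneS
  zetaFrom-zero = zetaFrom-unique (λ _ → 0) refl (λ n → trans (θ-oneS n) (sym (trans (*S-congˡ oneS zero≗ n) (*S-zeroˡ oneS n))))
    where
    zero≗ : countSeries (λ _ → 0) ≗ zeroS
    zero≗ zero    = refl
    zero≗ (suc l) = refl

  zetaFrom-+ : ∀ N M → zetaFrom (λ l → N l ℕ.+ M l) ≗ zetaFrom N *S zetaFrom M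
  zetaFrom-+ N M = zetaFrom-unique (λ l → N l ℕ.+ M l) refl θ-product
    where
    Z = zetaFrom N
    W = zetaFrom M
    θ-product : θ (Z *S W) ≗ countSeries (λ l → N l ℕ.+ M l) *S (Z *S W)
    θ-product n = begin
      θ (Z *S W) n                                             ≡⟨ θ-*S Z W n ⟩
      (θ Z *S W) n + (Z *S θ W) n                              ≡⟨ cong₂ _+_ (*S-congˡ W (θ-zetaFrom N) n) (*S-congʳ Z (θ-zetaFrom M) n) ⟩
      ((countSeries N *S Z) *S W) n + (Z *S (countSeries M *S W)) n
          ≡⟨ cong₂ _+_ (*S-assoc (countSeries N) Z W n)
                       (trans (sym (*S-assoc Z (countSeries M) W n)) (trans (*S-congˡ W (*S-comm Z (countSeries M)) n) (*S-assoc (countSeries M) Z W n))) ⟩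
      (countSeries N *S (Z *S W)) n + (countSeries M *S (Z *S W)) n ≡⟨ sym (*S-distribʳ (countSeries N) (countSeries M) (Z *S W) n) ⟩
      ((countSeries N +S countSeries M) *S (Z *S W)) n         ≡⟨ *S-congˡ (Z *S W) (λ k → sym (countSeries-+ N M k)) n ⟩
      (countSeries (λ l → N l ℕ.+ M l) *S (Z *S W)) n          ∎

  twice : ℕ → ℕ
  twice zero    = zero
  twice (suc k) = suc (suc (twice k))

  twice≡+ : ∀ k → twice k ≡ k ℕ.+ k
  twice≡+ zero    = refl
  twice≡+ (suc k) = cong suc (trans (cong suc (twice≡+ k)) (sym (ℕₚ.+-suc k k)))

  parity : ∀ n → ∃[ k ] (n ≡ twice k ⊎ n ≡ suc (twice k))
  parity zero          = zero , inj₁ refl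
  parity (suc zero)    = zero , inj₂ refl
  parity (suc (suc n)) with parity n
  ... | k , inj₁ refl = suc k , inj₁ refl
  ... | k , inj₂ refl = suc k , inj₂ refl

  sqS-twice : ∀ f k → sqS f (twice k) ≡ f k
  sqS-twice f zero    = refl
  sqS-twice f (suc k) = sqS-twice (f ∘ suc) k

  sqS-suc-twice : ∀ f k → sqS f (suc (twice k)) ≡ 0ℚ
  sqS-suc-twice f zero    = refl
  sqS-suc-twice f (suc k) = sqS-suc-twice (f ∘ suc) k

  sqS-cong : ∀ {f g} → f ≗ g → sqS f ≗ sqS g
  sqS-cong e zero          = e 0
  sqS-cong e (suc zero)    = refl
  sqS-cong e (suc (suc n)) = sqS-cong (e ∘ suc) n

  sqS-+S : ∀ f g → sqS (f +S g) ≗ sqS f +S sqS g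
  sqS-+S f g zero          = refl
  sqS-+S f g (suc zero)    = refl
  sqS-+S f g (suc (suc n)) = sqS-+S (f ∘ suc) (g ∘ suc) n

  sqS-·S : ∀ c f → sqS (c ·S f) ≗ c ·S sqS f
  sqS-·S c f zero          = refl
  sqS-·S c f (suc zero)    = sym (ℚₚ.*-zeroʳ c)
  sqS-·S c f (suc (suc n)) = sqS-·S c (f ∘ suc) n

  sqS-*S : ∀ f g → sqS (f *S g) ≗ sqS f *S sqS g
  sqS-*S f g zero          = refl
  sqS-*S f g (suc zero)    = sym (cong₂ _+_ (ℚₚ.*-zeroʳ (f 0)) (ℚₚ.*-zeroˡ (g 0)))
  sqS-*S f g (suc (suc n)) = begin
    sqS ((f *S g) ∘ suc) n                                   ≡⟨ sqS-cong (*S-suc f g) n ⟩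
    sqS (f 0 ·S (g ∘ suc) +S (f ∘ suc) *S g) n               ≡⟨ sqS-+S (f 0 ·S (g ∘ suc)) ((f ∘ suc) *S g) n ⟩
    sqS (f 0 ·S (g ∘ suc)) n + sqS ((f ∘ suc) *S g) n        ≡⟨ cong₂ _+_ (sqS-·S (f 0) (g ∘ suc) n) (sqS-*S (f ∘ suc) g n) ⟩
    f 0 * sqS g (suc (suc n)) + (sqS (f ∘ suc) *S sqS g) n   ≡⟨ cong (λ z → f 0 * sqS g (suc (suc n)) + z) (sym odd) ⟩
    f 0 * sqS g (suc (suc n)) + ((sqS f ∘ suc) *S sqS g) (suc n) ≡⟨ sym (*S-suc (sqS f) (sqS g) (suc n)) ⟩
    (sqS f *S sqS g) (suc (suc n))                           ∎
    where
    odd : ((sqS f ∘ suc) *S sqS g) (suc n) ≡ (sqS (f ∘ suc) *S sqS g) n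
    odd = *S-suc-vanishing (sqS f ∘ suc) (sqS g) n refl

  θ-sqS : ∀ f → θ (sqS f) ≗ sqS (θ f) +S sqS (θ f)
  θ-sqS f n with parity n
  ... | k , inj₁ refl = begin
    fromℕ (twice k) * sqS f (twice k)         ≡⟨ cong₂ _*_ (trans (cong fromℕ (twice≡+ k)) (fromℕ-+ k k)) (sqS-twice f k) ⟩
    (fromℕ k + fromℕ k) * f k                 ≡⟨ ℚₚ.*-distribʳ-+ (f k) (fromℕ k) (fromℕ k) ⟩
    θ f k + θ f k                             ≡⟨ sym (cong₂ _+_ (sqS-twice (θ f) k) (sqS-twice (θ f) k)) ⟩
    sqS (θ f) (twice k) + sqS (θ f) (twice k) ∎
  ... | k , inj₂ refl = begin
    fromℕ (suc (twice k)) * sqS f (suc (twice k))  ≡⟨ cong (fromℕ (suc (twice k)) *_) (sqS-suc-twice f k) ⟩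
    fromℕ (suc (twice k)) * 0ℚ                     ≡⟨ ℚₚ.*-zeroʳ (fromℕ (suc (twice k))) ⟩
    0ℚ + 0ℚ                                        ≡⟨ sym (cong₂ _+_ (sqS-suc-twice (θ f) k) (sqS-suc-twice (θ f) k)) ⟩
    sqS (θ f) (suc (twice k)) + sqS (θ f) (suc (twice k)) ∎

  -- the counting analogue of f(u) ↦ f(u²)
  sqN : (ℕ → ℕ) → ℕ → ℕ
  sqN N zero          = N zero
  sqN N (suc zero)    = 0
  sqN N (suc (suc l)) = sqN (N ∘ suc) l

  sqN-twice : ∀ N k → sqN N (twice k) ≡ N k
  sqN-twice N zero    = refl
  sqN-twice N (suc k) = sqN-twice (N ∘ suc) k

  sqN-suc-twice : ∀ N k → sqN N (suc (twice k)) ≡ 0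
  sqN-suc-twice N zero    = refl
  sqN-suc-twice N (suc k) = sqN-suc-twice (N ∘ suc) k

  sqN-cong : ∀ {N M} → (∀ k → N k ≡ M k) → ∀ l → sqN N l ≡ sqN M l
  sqN-cong e zero          = e 0
  sqN-cong e (suc zero)    = refl
  sqN-cong e (suc (suc l)) = sqN-cong (e ∘ suc) l

  sqN-cong⁺ : ∀ {N M} → (∀ k → N (suc k) ≡ M (suc k)) → ∀ l → sqN N (suc l) ≡ sqN M (suc l)
  sqN-cong⁺ e zero    = refl
  sqN-cong⁺ e (suc l) = sqN-cong e l

  sqN-+ : ∀ N M l → sqN (λ k → N k ℕ.+ M k) l ≡ sqN N l ℕ.+ sqN M l
  sqN-+ N M zero          = refl
  sqN-+ N M (suc zero)    = refl
  sqN-+ N M (suc (suc l)) = sqN-+ (N ∘ suc) (M ∘ suc) l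

  sqN-zero : ∀ l → sqN (λ _ → 0) l ≡ 0
  sqN-zero zero          = refl
  sqN-zero (suc zero)    = refl
  sqN-zero (suc (suc l)) = sqN-zero l

  countSeries-sqN : ∀ N → countSeries (sqN N) ≗ sqS (countSeries N)
  countSeries-sqN N n with parity n
  ... | zero  , inj₁ refl = refl
  ... | suc k , inj₁ refl = trans (cong fromℕ (sqN-twice N (suc k))) (sym (sqS-twice (countSeries N) (suc k)))
  ... | k     , inj₂ refl = trans (cong fromℕ (sqN-suc-twice N k)) (sym (sqS-suc-twice (countSeries N) k))

  doubledSqN : (ℕ → ℕ) → ℕ → ℕ
  doubledSqN N l = sqN N l ℕ.+ sqN N l

  zetaFrom-doubledSqN : ∀ N → zetaFrom (doubledSqN N) ≗ sqS (zetaFrom N)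
  zetaFrom-doubledSqN N = zetaFrom-unique (doubledSqN N) refl θ-sq
    where
    Z = zetaFrom N
    c = countSeries N
    θ-sq : θ (sqS Z) ≗ countSeries (doubledSqN N) *S sqS Z
    θ-sq n = begin
      θ (sqS Z) n                                      ≡⟨ θ-sqS Z n ⟩
      sqS (θ Z) n + sqS (θ Z) n                        ≡⟨ cong (λ z → z + z) (trans (sqS-cong (θ-zetaFrom N) n) (sqS-*S c Z n)) ⟩
      (sqS c *S sqS Z) n + (sqS c *S sqS Z) n          ≡⟨ sym (*S-distribʳ (sqS c) (sqS c) (sqS Z) n) ⟩
      ((sqS c +S sqS c) *S sqS Z) n
        ≡⟨ *S-congˡ (sqS Z) (λ k → sym (trans (countSeries-+ (sqN N) (sqN N) k) (cong (λ z → z + z) (countSeries-sqN N k)))) n ⟩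
      (countSeries (doubledSqN N) *S sqS Z) n ∎

  sumAt : List (ℕ → ℕ) → ℕ → ℕ
  sumAt []       l = 0
  sumAt (N ∷ Ns) l = N l ℕ.+ sumAt Ns l

  sumAt-++ : ∀ Ns Ms l → sumAt (Ns ++ Ms) l ≡ sumAt Ns l ℕ.+ sumAt Ms l
  sumAt-++ []       Ms l = refl
  sumAt-++ (N ∷ Ns) Ms l = trans (cong (N l ℕ.+_) (sumAt-++ Ns Ms l)) (sym (ℕₚ.+-assoc (N l) _ _))

  sqN-sumAt : ∀ Ns l → sqN (sumAt Ns) l ≡ sumAt (map sqN Ns) l
  sqN-sumAt []       l = sqN-zero l
  sqN-sumAt (N ∷ Ns) l = trans (sqN-+ N (sumAt Ns) l) (cong (sqN N l ℕ.+_) (sqN-sumAt Ns l))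

  sumAt-doubledSqN : ∀ Ns l → sumAt (map doubledSqN Ns) l ≡ sumAt (map sqN Ns) l ℕ.+ sumAt (map sqN Ns) l
  sumAt-doubledSqN []       l = refl
  sumAt-doubledSqN (N ∷ Ns) l = trans (cong (doubledSqN N l ℕ.+_) (sumAt-doubledSqN Ns l)) (+-interchange (sqN N l) (sqN N l) _ _)

  zetaFrom-sumAt : ∀ Ns → zetaFrom (sumAt Ns) ≗ prodS (map zetaFrom Ns)
  zetaFrom-sumAt []       = zetaFrom-zero
  zetaFrom-sumAt (N ∷ Ns) n = trans (zetaFrom-+ N (sumAt Ns) n) (*S-congʳ (zetaFrom N) (zetaFrom-sumAt Ns) n)

  prodS-++ : ∀ fs gs → prodS (fs ++ gs) ≗ prodS fs *S prodS gs
  prodS-++ []       gs n = sym (*S-identityˡ (prodS gs) n)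
  prodS-++ (f ∷ fs) gs n = trans (*S-congʳ f (prodS-++ fs gs) n) (sym (*S-assoc f (prodS fs) (prodS gs) n))

  prodS-map-zetaFrom : ∀ {A : Set} (N : A → ℕ → ℕ) {g : A → Series} → (∀ x → zetaFrom (N x) ≗ g x) →
    ∀ xs → prodS (map zetaFrom (map N xs)) ≗ prodS (map g xs)
  prodS-map-zetaFrom N e []       n = refl
  prodS-map-zetaFrom N e (x ∷ xs)   = *S-cong (e x) (prodS-map-zetaFrom N e xs)

module Counting where

  open PowerSeries using (twice)
  open import Function using (case_of_)
  open import Data.Bool using (Bool; true; false; _∧_; not; if_then_else_; T?)
  import Data.Bool.Properties as Boolₚ
  open import Data.Bool.ListAction using (all)
  open import Data.Nat using (zero; suc; _+_)
  import Data.Nat.Properties as ℕₚ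
  open import Data.Nat.ListAction using (sum)
  open import Data.Nat.ListAction.Properties using (sum-++)
  open import Data.List using (concatMap; length; filterᵇ)
  open import Data.Product as Product using (_×_; proj₁; proj₂; swap)
  open import Data.Sum using (_⊎_; inj₁; inj₂)
  open import Data.Unit using (⊤; tt)
  open import Relation.Binary.PropositionalEquality
  open import Algebra.Properties.CommutativeSemigroup ℕₚ.+-commutativeSemigroup using () renaming (interchange to +-interchange)
  open ≡-Reasoning

  private
    variable
      A B C : Set

  ∧-congʳ-when : ∀ {a b} c → (c ≡ true → a ≡ b) → a ∧ c ≡ b ∧ c
  ∧-congʳ-when true  e = cong (_∧ true) (e refl)
  ∧-congʳ-when {a} {b} false e = trans (Boolₚ.∧-zeroʳ a) (sym (Boolₚ.∧-zeroʳ b))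

  ∧≡true⇒ʳ : ∀ a {b} → a ∧ b ≡ true → b ≡ true
  ∧≡true⇒ʳ true e = e

  count-++ : ∀ p (xs ys : List A) → count p (xs ++ ys) ≡ count p xs + count p ys
  count-++ p []       ys = refl
  count-++ p (x ∷ xs) ys with p x
  ... | true  = cong suc (count-++ p xs ys)
  ... | false = count-++ p xs ys

  count-map : ∀ p (f : A → B) xs → count p (map f xs) ≡ count (p ∘ f) xs
  count-map p f []       = refl
  count-map p f (x ∷ xs) with p (f x)
  ... | true  = cong suc (count-map p f xs)
  ... | false = count-map p f xs

  count-cong : ∀ {p q : A → Bool} → (∀ x → p x ≡ q x) → ∀ xs → count p xs ≡ count q xs
  count-cong e []       = refl
  count-cong {p = p} {q} e (x ∷ xs) with p x | q x | e x
  ... | true  | true  | refl = cong suc (count-cong e xs)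
  ... | false | false | refl = count-cong e xs

  count-none : ∀ {p : A → Bool} → (∀ x → p x ≡ false) → ∀ xs → count p xs ≡ 0
  count-none e []       = refl
  count-none {p = p} e (x ∷ xs) with p x | e x
  ... | false | refl = count-none e xs

  count-split : ∀ (q p : A → Bool) xs → count p xs ≡ count (λ x → q x ∧ p x) xs + count (λ x → not (q x) ∧ p x) xs
  count-split q p []       = refl
  count-split q p (x ∷ xs) with q x | p x
  ... | true  | true  = cong suc (count-split q p xs)
  ... | true  | false = count-split q p xs
  ... | false | true  = trans (cong suc (count-split q p xs)) (sym (ℕₚ.+-suc _ _))
  ... | false | false = count-split q p xs

  count-concatMap : ∀ p (f : A → List B) xs → count p (concatMap f xs) ≡ sum (map (count p ∘ f) xs)
  count-concatMap p f []       = refl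
  count-concatMap p f (x ∷ xs) = trans (count-++ p (f x) (concatMap f xs)) (cong (count p (f x) +_) (count-concatMap p f xs))

  sum-map-cong : ∀ {f g : A → ℕ} → (∀ x → f x ≡ g x) → ∀ xs → sum (map f xs) ≡ sum (map g xs)
  sum-map-cong e xs = cong sum (Listₚ.map-cong e xs)

  count-listsOf-suc : ∀ p (xs : List A) l → count p (listsOf xs (suc l)) ≡ sum (map (λ a → count (p ∘ (a ∷_)) (listsOf xs l)) xs)
  count-listsOf-suc p xs l = trans (count-concatMap p (λ a → map (a ∷_) (listsOf xs l)) xs)
    (sum-map-cong (λ a → count-map p (a ∷_) (listsOf xs l)) xs)

  count-listsOf-cong : ∀ {p q : List A → Bool} xs l → (∀ s → length s ≡ l → p s ≡ q s) → count p (listsOf xs l) ≡ count q (listsOf xs l)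
  count-listsOf-cong {p = p} {q} xs zero    e with p [] | q [] | e [] refl
  ... | true  | true  | refl = refl
  ... | false | false | refl = refl
  count-listsOf-cong {p = p} {q} xs (suc l) e = begin
    count p (listsOf xs (suc l))                              ≡⟨ count-listsOf-suc p xs l ⟩
    sum (map (λ a → count (p ∘ (a ∷_)) (listsOf xs l)) xs)   ≡⟨ sum-map-cong (λ a → count-listsOf-cong xs l (λ s e' → e (a ∷ s) (cong suc e'))) xs ⟩
    sum (map (λ a → count (q ∘ (a ∷_)) (listsOf xs l)) xs)   ≡⟨ sym (count-listsOf-suc q xs l) ⟩
    count q (listsOf xs (suc l))                              ∎

  sum-filter : ∀ (p : A → Bool) (g : A → ℕ) xs → sum (map g (filterᵇ p xs)) ≡ sum (map (λ x → if p x then g x else 0) xs)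
  sum-filter p g []       = refl
  sum-filter p g (x ∷ xs) with p x
  ... | true  = cong (g x +_) (sum-filter p g xs)
  ... | false = sum-filter p g xs

  count-listsOf-all : ∀ (p : A → Bool) q xs l → count (λ s → all p s ∧ q s) (listsOf xs l) ≡ count q (listsOf (filterᵇ p xs) l)
  count-listsOf-all p q xs zero    with q []
  ... | true  = refl
  ... | false = refl
  count-listsOf-all p q xs (suc l) = begin
    count (λ s → all p s ∧ q s) (listsOf xs (suc l))
      ≡⟨ count-listsOf-suc _ xs l ⟩
    sum (map (λ a → count (λ s → (p a ∧ all p s) ∧ q (a ∷ s)) (listsOf xs l)) xs)
      ≡⟨ sum-map-cong head xs ⟩
    sum (map (λ a → if p a then count (q ∘ (a ∷_)) (listsOf (filterᵇ p xs) l) else 0) xs)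
      ≡⟨ sym (sum-filter p _ xs) ⟩
    sum (map (λ a → count (q ∘ (a ∷_)) (listsOf (filterᵇ p xs) l)) (filterᵇ p xs))
      ≡⟨ sym (count-listsOf-suc q (filterᵇ p xs) l) ⟩
    count q (listsOf (filterᵇ p xs) (suc l)) ∎
    where
    head : ∀ a → count (λ s → (p a ∧ all p s) ∧ q (a ∷ s)) (listsOf xs l)
               ≡ (if p a then count (q ∘ (a ∷_)) (listsOf (filterᵇ p xs) l) else 0)
    head a with p a
    ... | true  = count-listsOf-all p (q ∘ (a ∷_)) xs l
    ... | false = count-none (λ _ → refl) (listsOf xs l)

  count-listsOf-map : ∀ p (f : A → B) xs l → count p (listsOf (map f xs) l) ≡ count (p ∘ map f) (listsOf xs l)
  count-listsOf-map p f xs zero    with p []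
  ... | true  = refl
  ... | false = refl
  count-listsOf-map p f xs (suc l) = begin
    count p (listsOf (map f xs) (suc l))                                   ≡⟨ count-listsOf-suc p (map f xs) l ⟩
    sum (map (λ b → count (p ∘ (b ∷_)) (listsOf (map f xs) l)) (map f xs)) ≡⟨ cong sum (sym (Listₚ.map-∘ xs)) ⟩
    sum (map (λ a → count (p ∘ (f a ∷_)) (listsOf (map f xs) l)) xs)       ≡⟨ sum-map-cong (λ a → count-listsOf-map (p ∘ (f a ∷_)) f xs l) xs ⟩
    sum (map (λ a → count (p ∘ map f ∘ (a ∷_)) (listsOf xs l)) xs)         ≡⟨ sym (count-listsOf-suc (p ∘ map f) xs l) ⟩
    count (p ∘ map f) (listsOf xs (suc l))                                 ∎

  sum-map-+ : ∀ (f g : A → ℕ) xs → sum (map (λ x → f x + g x) xs) ≡ sum (map f xs) + sum (map g xs)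
  sum-map-+ f g []       = refl
  sum-map-+ f g (x ∷ xs) = trans (cong (f x + g x +_) (sum-map-+ f g xs)) (+-interchange (f x) (g x) _ _)

  sum-map-zero : ∀ (xs : List A) → sum (map (λ _ → 0) xs) ≡ 0
  sum-map-zero []       = refl
  sum-map-zero (x ∷ xs) = sum-map-zero xs

  sum-comm : ∀ (F : A → B → ℕ) xs ys →
    sum (map (λ a → sum (map (F a) ys)) xs) ≡ sum (map (λ b → sum (map (λ a → F a b) xs)) ys)
  sum-comm F []       ys = sym (sum-map-zero ys)
  sum-comm F (x ∷ xs) ys = trans (cong (sum (map (F x) ys) +_) (sum-comm F xs ys))
    (sym (sum-map-+ (F x) (λ b → sum (map (λ a → F a b) xs)) ys))

  pairsOf : List A → List B → List (A × B)
  pairsOf xs ys = concatMap (λ x → map (x ,_) ys) xs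

  pairsOf-[] : ∀ (xs : List A) → pairsOf {B = B} xs [] ≡ []
  pairsOf-[] []       = refl
  pairsOf-[] (x ∷ xs) = pairsOf-[] xs

  pairsOf-map : ∀ (f : A → C) (g : B → C) xs ys →
    pairsOf (map f xs) (map g ys) ≡ map (Product.map f g) (pairsOf xs ys)
  pairsOf-map f g []       ys = refl
  pairsOf-map f g (x ∷ xs) ys = begin
    map (f x ,_) (map g ys) ++ pairsOf (map f xs) (map g ys)  ≡⟨ cong₂ _++_ (sym (Listₚ.map-∘ ys)) (pairsOf-map f g xs ys) ⟩
    map (λ y → f x , g y) ys ++ map (Product.map f g) (pairsOf xs ys)   ≡⟨ cong (_++ _) (Listₚ.map-∘ ys) ⟩
    map (Product.map f g) (map (x ,_) ys) ++ map (Product.map f g) (pairsOf xs ys) ≡⟨ sym (Listₚ.map-++ _ (map (x ,_) ys) _) ⟩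
    map (Product.map f g) (map (x ,_) ys ++ pairsOf xs ys) ∎

  pairsOf-mapʳ : ∀ (g : B → C) (xs : List A) ys → pairsOf xs (map g ys) ≡ map (Product.map₂ g) (pairsOf xs ys)
  pairsOf-mapʳ g []       ys = refl
  pairsOf-mapʳ g (x ∷ xs) ys = begin
    map (x ,_) (map g ys) ++ pairsOf xs (map g ys)                            ≡⟨ cong₂ _++_ (sym (Listₚ.map-∘ ys)) (pairsOf-mapʳ g xs ys) ⟩
    map (λ y → x , g y) ys ++ map (Product.map₂ g) (pairsOf xs ys)      ≡⟨ cong (_++ _) (Listₚ.map-∘ ys) ⟩
    map (Product.map₂ g) (map (x ,_) ys) ++ map (Product.map₂ g) (pairsOf xs ys) ≡⟨ sym (Listₚ.map-++ _ (map (x ,_) ys) _) ⟩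
    map (Product.map₂ g) (map (x ,_) ys ++ pairsOf xs ys) ∎

  sum-pairsOf : ∀ (g : A × B → ℕ) xs ys → sum (map g (pairsOf xs ys)) ≡ sum (map (λ a → sum (map (λ b → g (a , b)) ys)) xs)
  sum-pairsOf g []       ys = refl
  sum-pairsOf g (x ∷ xs) ys = begin
    sum (map g (map (x ,_) ys ++ pairsOf xs ys))               ≡⟨ cong sum (Listₚ.map-++ g (map (x ,_) ys) (pairsOf xs ys)) ⟩
    sum (map g (map (x ,_) ys) ++ map g (pairsOf xs ys))       ≡⟨ sum-++ (map g (map (x ,_) ys)) _ ⟩
    sum (map g (map (x ,_) ys)) + sum (map g (pairsOf xs ys))  ≡⟨ cong₂ _+_ (cong sum (sym (Listₚ.map-∘ ys))) (sum-pairsOf g xs ys) ⟩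
    sum (map (λ b → g (x , b)) ys) + sum (map (λ a → sum (map (λ b → g (a , b)) ys)) xs) ∎

  filterᵇ-map : ∀ (p : B → Bool) (f : A → B) xs → filterᵇ p (map f xs) ≡ map f (filterᵇ (p ∘ f) xs)
  filterᵇ-map p f []       = refl
  filterᵇ-map p f (x ∷ xs) with p (f x)
  ... | true  = cong (f x ∷_) (filterᵇ-map p f xs)
  ... | false = filterᵇ-map p f xs

  filterᵇ-none : ∀ {p : A → Bool} → (∀ x → p x ≡ false) → ∀ xs → filterᵇ p xs ≡ []
  filterᵇ-none e []       = refl
  filterᵇ-none {p = p} e (x ∷ xs) with p x | e x
  ... | false | refl = filterᵇ-none e xs

  filterᵇ-all : ∀ {p : A → Bool} → (∀ x → p x ≡ true) → ∀ xs → filterᵇ p xs ≡ xs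
  filterᵇ-all e []       = refl
  filterᵇ-all {p = p} e (x ∷ xs) with p x | e x
  ... | true | refl = cong (x ∷_) (filterᵇ-all e xs)

  filterᵇ-pairsOf : ∀ (p : A → Bool) (q : B → Bool) xs ys →
    filterᵇ (λ xy → p (proj₁ xy) ∧ q (proj₂ xy)) (pairsOf xs ys) ≡ pairsOf (filterᵇ p xs) (filterᵇ q ys)
  filterᵇ-pairsOf p q []       ys = refl
  filterᵇ-pairsOf p q (x ∷ xs) ys
    rewrite Listₚ.filter-++ (T? ∘ λ xy → p (proj₁ xy) ∧ q (proj₂ xy)) (map (x ,_) ys) (pairsOf xs ys)
          | filterᵇ-map (λ xy → p (proj₁ xy) ∧ q (proj₂ xy)) (x ,_) ys
          | filterᵇ-pairsOf p q xs ys
    with p x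
  ... | true  = refl
  ... | false = cong (λ zs → map (x ,_) zs ++ pairsOf (filterᵇ p xs) (filterᵇ q ys)) (filterᵇ-none (λ _ → refl) ys)

  isInj₁ : A ⊎ B → Bool
  isInj₁ (inj₁ _) = true
  isInj₁ (inj₂ _) = false

  module _ {A B : Set} {p : A ⊎ B → Bool} (as : List A) (bs : List B) where

    filterᵇ-inj₁ : (∀ a → p (inj₁ a) ≡ true) → (∀ b → p (inj₂ b) ≡ false) → filterᵇ p (map inj₁ as ++ map inj₂ bs) ≡ map inj₁ as
    filterᵇ-inj₁ p₁ p₂ = begin
      filterᵇ p (map inj₁ as ++ map inj₂ bs)                  ≡⟨ Listₚ.filter-++ (T? ∘ p) (map inj₁ as) (map inj₂ bs) ⟩
      filterᵇ p (map inj₁ as) ++ filterᵇ p (map inj₂ bs)      ≡⟨ cong₂ _++_ (trans (filterᵇ-map p inj₁ as) (cong (map inj₁) (filterᵇ-all p₁ as)))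
                                                                            (trans (filterᵇ-map p inj₂ bs) (cong (map inj₂) (filterᵇ-none p₂ bs))) ⟩
      map inj₁ as ++ []                                       ≡⟨ Listₚ.++-identityʳ (map inj₁ as) ⟩
      map inj₁ as                                             ∎

    filterᵇ-inj₂ : (∀ a → p (inj₁ a) ≡ false) → (∀ b → p (inj₂ b) ≡ true) → filterᵇ p (map inj₁ as ++ map inj₂ bs) ≡ map inj₂ bs
    filterᵇ-inj₂ p₁ p₂ = begin
      filterᵇ p (map inj₁ as ++ map inj₂ bs)                  ≡⟨ Listₚ.filter-++ (T? ∘ p) (map inj₁ as) (map inj₂ bs) ⟩
      filterᵇ p (map inj₁ as) ++ filterᵇ p (map inj₂ bs)      ≡⟨ cong₂ _++_ (trans (filterᵇ-map p inj₁ as) (cong (map inj₁) (filterᵇ-none p₁ as)))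
                                                                            (trans (filterᵇ-map p inj₂ bs) (cong (map inj₂) (filterᵇ-all p₂ bs))) ⟩
      map inj₂ bs                                             ∎

  flatten : List (A × A) → List A
  flatten []             = []
  flatten ((a , b) ∷ ps) = a ∷ b ∷ flatten ps

  count-listsOf-twice : ∀ p (xs : List A) m → count p (listsOf xs (twice m)) ≡ count (p ∘ flatten) (listsOf (pairsOf xs xs) m)
  count-listsOf-twice p xs zero    with p []
  ... | true  = refl
  ... | false = refl
  count-listsOf-twice p xs (suc m) = begin
    count p (listsOf xs (suc (suc (twice m))))
      ≡⟨ count-listsOf-suc p xs (suc (twice m)) ⟩
    sum (map (λ a → count (p ∘ (a ∷_)) (listsOf xs (suc (twice m)))) xs)
      ≡⟨ sum-map-cong (λ a → count-listsOf-suc (p ∘ (a ∷_)) xs (twice m)) xs ⟩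
    sum (map (λ a → sum (map (λ b → count (p ∘ (λ s → a ∷ b ∷ s)) (listsOf xs (twice m))) xs)) xs)
      ≡⟨ sum-map-cong (λ a → sum-map-cong (λ b → count-listsOf-twice (p ∘ (λ s → a ∷ b ∷ s)) xs m) xs) xs ⟩
    sum (map (λ a → sum (map (λ b → count (p ∘ flatten ∘ ((a , b) ∷_)) (listsOf (pairsOf xs xs) m)) xs)) xs)
      ≡⟨ sym (sum-pairsOf (λ ab → count (p ∘ flatten ∘ (ab ∷_)) (listsOf (pairsOf xs xs) m)) xs xs) ⟩
    sum (map (λ ab → count (p ∘ flatten ∘ (ab ∷_)) (listsOf (pairsOf xs xs) m)) (pairsOf xs xs))
      ≡⟨ sym (count-listsOf-suc (p ∘ flatten) (pairsOf xs xs) m) ⟩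
    count (p ∘ flatten) (listsOf (pairsOf xs xs) (suc m)) ∎

  count-listsOf-swap : ∀ p (xs : List A) (ys : List B) m →
    count p (listsOf (pairsOf xs ys) m) ≡ count (p ∘ map swap) (listsOf (pairsOf ys xs) m)
  count-listsOf-swap p xs ys zero    with p []
  ... | true  = refl
  ... | false = refl
  count-listsOf-swap p xs ys (suc m) = begin
    count p (listsOf (pairsOf xs ys) (suc m))
      ≡⟨ count-listsOf-suc p (pairsOf xs ys) m ⟩
    sum (map (λ ab → count (p ∘ (ab ∷_)) (listsOf (pairsOf xs ys) m)) (pairsOf xs ys))
      ≡⟨ sum-pairsOf _ xs ys ⟩
    sum (map (λ a → sum (map (λ b → count (p ∘ ((a , b) ∷_)) (listsOf (pairsOf xs ys) m)) ys)) xs)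
      ≡⟨ sum-map-cong (λ a → sum-map-cong (λ b → count-listsOf-swap (p ∘ ((a , b) ∷_)) xs ys m) ys) xs ⟩
    sum (map (λ a → sum (map (λ b → count (p ∘ map swap ∘ ((b , a) ∷_)) (listsOf (pairsOf ys xs) m)) ys)) xs)
      ≡⟨ sum-comm (λ a b → count (p ∘ map swap ∘ ((b , a) ∷_)) (listsOf (pairsOf ys xs) m)) xs ys ⟩
    sum (map (λ b → sum (map (λ a → count (p ∘ map swap ∘ ((b , a) ∷_)) (listsOf (pairsOf ys xs) m)) xs)) ys)
      ≡⟨ sym (sum-pairsOf (λ ba → count (p ∘ map swap ∘ (ba ∷_)) (listsOf (pairsOf ys xs) m)) ys xs) ⟩
    sum (map (λ ba → count (p ∘ map swap ∘ (ba ∷_)) (listsOf (pairsOf ys xs) m)) (pairsOf ys xs))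
      ≡⟨ sym (count-listsOf-suc (p ∘ map swap) (pairsOf ys xs) m) ⟩
    count (p ∘ map swap) (listsOf (pairsOf ys xs) (suc m)) ∎

  Alternates : (A → Bool) → Bool → Bool → List A → Set
  Alternates f a b []      = ⊤
  Alternates f a b (x ∷ s) = f x ≡ a × Alternates f b a s

  Alternates-++ˡ : ∀ {f : A → Bool} {a b} s {t} → Alternates f a b (s ++ t) → Alternates f a b s
  Alternates-++ˡ []      _         = tt
  Alternates-++ˡ (x ∷ s) (fx , al) = fx , Alternates-++ˡ s al

  Alternates-map : ∀ {f : A → Bool} {a b} (g : Bool → Bool) s → Alternates f a b s → Alternates (g ∘ f) (g a) (g b) s
  Alternates-map g []      _         = tt
  Alternates-map g (x ∷ s) (fx , al) = cong g fx , Alternates-map g s al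

  allPairs-alternates : ∀ {r : A → A → Bool} {f : A → Bool} → (∀ x y → r x y ≡ true → f x ≡ f y) →
    ∀ x s → allPairs r (x ∷ s) ≡ true → Alternates f (f x) (f x) (x ∷ s)
  allPairs-alternates keep x []      _ = refl , tt
  allPairs-alternates {r = r} {f} keep x (y ∷ s) rs with r x y in rxy
  ... | true rewrite keep x y rxy = refl , allPairs-alternates keep y s rs

  allTriples-alternates : ∀ {r : A → A → A → Bool} {f : A → Bool} → (∀ x y z → r x y z ≡ true → f x ≡ f z) →
    ∀ x y s → allTriples r (x ∷ y ∷ s) ≡ true → Alternates f (f x) (f y) (x ∷ y ∷ s)
  allTriples-alternates keep x y []      _ = refl , refl , tt
  allTriples-alternates {r = r} {f} keep x y (z ∷ s) rs with r x y z in rxyz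
  ... | true with allTriples-alternates keep y z s rs
  ...   | fy , al rewrite keep x y z rxyz = refl , fy , al

  Alternates-all : ∀ {f : A → Bool} {a b} (g : Bool → Bool) → g a ≡ true → g b ≡ true → ∀ s → Alternates f a b s → all (g ∘ f) s ≡ true
  Alternates-all g ga gb []      _          = refl
  Alternates-all g ga gb (x ∷ s) (refl , al) rewrite ga = Alternates-all g gb ga s al

  all-Alternates : ∀ {f : A → Bool} {a b} (g : Bool → Bool) x y s → Alternates f a b (x ∷ y ∷ s) → all (g ∘ f) (x ∷ y ∷ s) ≡ g a ∧ g b
  all-Alternates {a = a} {b} g x y s (fx , fy , al) rewrite fx | fy with g a in ga | g b in gb
  ... | true  | true  = Alternates-all g ga gb s al
  ... | true  | false = refl
  ... | false | _     = refl

  all-Alternates-const : ∀ {f : A → Bool} {a} (g : Bool → Bool) x s → Alternates f a a (x ∷ s) → all (g ∘ f) (x ∷ s) ≡ g a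
  all-Alternates-const {a = a} g x s (fx , al) rewrite fx with g a in ga
  ... | true  = Alternates-all g ga ga s al
  ... | false = refl

  alternating : (A → Bool) → (A → Bool) → List A → Bool
  alternating p q []          = true
  alternating p q (x ∷ [])    = false
  alternating p q (x ∷ y ∷ s) = p x ∧ q y ∧ alternating p q s

  alternating-flatten : ∀ (p q : A → Bool) ps → alternating p q (flatten ps) ≡ all (λ xy → p (proj₁ xy) ∧ q (proj₂ xy)) ps
  alternating-flatten p q []             = refl
  alternating-flatten p q ((x , y) ∷ ps) = trans (cong (λ z → p x ∧ q y ∧ z) (alternating-flatten p q ps)) (sym (Boolₚ.∧-assoc (p x) (q y) _))

  -- In a cycle x₀ … x_{l-1} x₀ whose colours alternate, l is even.
  Alternates-alternating : ∀ {p : A → Bool} s {x t} → Alternates p true false (s ++ x ∷ t) → p x ≡ true → alternating p (not ∘ p) s ≡ true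
  Alternates-alternating []              _                     _    = refl
  Alternates-alternating (y ∷ [])        (_ , px≡false , _)    px   = case trans (sym px) px≡false of λ ()
  Alternates-alternating (y ∷ z ∷ s)     (py , pz , al)        px   rewrite py | pz = Alternates-alternating s al px

  alternating-Alternates : ∀ {f : A → Bool} {a b} (g : Bool → Bool) x y s →
    Alternates f a b (x ∷ y ∷ s ++ x ∷ y ∷ []) → alternating (g ∘ f) (not ∘ g ∘ f) (x ∷ y ∷ s) ≡ g a ∧ not (g b)
  alternating-Alternates {f = f} {a} {b} g x y s al@(fx , fy , _) with g a in ga | g b in gb
  ... | true  | false = Alternates-alternating {p = g ∘ f} (x ∷ y ∷ s)
    (subst₂ (λ u v → Alternates (g ∘ f) u v (x ∷ y ∷ s ++ x ∷ y ∷ [])) ga gb (Alternates-map g (x ∷ y ∷ s ++ x ∷ y ∷ []) al))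
    (trans (cong g fx) ga)
  ... | true  | true  rewrite fx | fy | ga | gb = refl
  ... | false | _     rewrite fx | ga = refl

  alternating-odd : ∀ (p q : A → Bool) k s → length s ≡ suc (twice k) → alternating p q s ≡ false
  alternating-odd p q zero    (x ∷ [])    _  = refl
  alternating-odd p q (suc k) (x ∷ y ∷ s) eq rewrite alternating-odd p q k s (ℕₚ.suc-injective (ℕₚ.suc-injective eq)) =
    trans (cong (p x ∧_) (Boolₚ.∧-zeroʳ (q y))) (Boolₚ.∧-zeroʳ (p x))

  allPairs-map : ∀ (r : B → B → Bool) (f : A → B) xs → allPairs r (map f xs) ≡ allPairs (λ x y → r (f x) (f y)) xs
  allPairs-map r f []           = refl
  allPairs-map r f (x ∷ [])     = refl
  allPairs-map r f (x ∷ y ∷ xs) = cong (r (f x) (f y) ∧_) (allPairs-map r f (y ∷ xs))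

  allPairs-cong : ∀ {r r' : A → A → Bool} → (∀ x y → r x y ≡ r' x y) → ∀ xs → allPairs r xs ≡ allPairs r' xs
  allPairs-cong e []           = refl
  allPairs-cong e (x ∷ [])     = refl
  allPairs-cong e (x ∷ y ∷ xs) = cong₂ _∧_ (e x y) (allPairs-cong e (y ∷ xs))

  allTriples-map : ∀ (r : B → B → B → Bool) (f : A → B) xs → allTriples r (map f xs) ≡ allTriples (λ x y z → r (f x) (f y) (f z)) xs
  allTriples-map r f []               = refl
  allTriples-map r f (x ∷ [])         = refl
  allTriples-map r f (x ∷ y ∷ [])     = refl
  allTriples-map r f (x ∷ y ∷ z ∷ xs) = cong (r (f x) (f y) (f z) ∧_) (allTriples-map r f (y ∷ z ∷ xs))

  module _ {ι : A → C} {κ : B → C} where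

    allPairs-flatten : ∀ {r : C → C → Bool} → (∀ a b → r (ι a) (κ b) ≡ true) → (∀ b a → r (κ b) (ι a) ≡ true) →
      ∀ ps → allPairs r (flatten (map (Product.map ι κ) ps)) ≡ true
    allPairs-flatten rικ rκι []                      = refl
    allPairs-flatten rικ rκι ((a , b) ∷ [])          = cong (_∧ true) (rικ a b)
    allPairs-flatten rικ rκι ((a , b) ∷ (a' , b') ∷ ps) =
      cong₂ _∧_ (rικ a b) (cong₂ _∧_ (rκι b a') (allPairs-flatten rικ rκι ((a' , b') ∷ ps)))

    allTriples-flatten : ∀ (r : C → C → C → Bool) ps → allTriples r (flatten (map (Product.map ι κ) ps))
      ≡ allPairs (λ p p' → r (ι (proj₁ p)) (κ (proj₂ p)) (ι (proj₁ p')) ∧ r (κ (proj₂ p)) (ι (proj₁ p')) (κ (proj₂ p'))) ps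
    allTriples-flatten r []                           = refl
    allTriples-flatten r ((a , b) ∷ [])               = refl
    allTriples-flatten r ((a , b) ∷ (a' , b') ∷ ps)   =
      trans (cong (λ z → r (ι a) (κ b) (ι a') ∧ r (κ b) (ι a') (κ b') ∧ z) (allTriples-flatten r ((a' , b') ∷ ps)))
            (sym (Boolₚ.∧-assoc (r (ι a) (κ b) (ι a')) _ _))

  module _ (F : FiniteField) where

    closeUp-map : ∀ (f : A → B) s → closeUp F (map f s) ≡ map f (closeUp F s)
    closeUp-map f []       = refl
    closeUp-map f (x ∷ xs) = cong (f x ∷_) (sym (Listₚ.map-++ f xs (x ∷ [])))

    cycleExt-map : ∀ (f : A → B) s → cycleExt F (map f s) ≡ map f (cycleExt F s)
    cycleExt-map f []           = refl
    cycleExt-map f (x ∷ [])     = refl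
    cycleExt-map f (x ∷ y ∷ xs) = cong (λ z → f x ∷ f y ∷ z) (sym (Listₚ.map-++ f xs (x ∷ y ∷ [])))

    cycleExt-flatten : ∀ (p : A × A) ps → cycleExt F (flatten (p ∷ ps)) ≡ flatten (closeUp F (p ∷ ps))
    cycleExt-flatten (a , b) ps = cong (λ z → a ∷ b ∷ z) (flatten-++ ps)
      where
      flatten-++ : ∀ ps → flatten ps ++ a ∷ b ∷ [] ≡ flatten (ps ++ (a , b) ∷ [])
      flatten-++ []             = refl
      flatten-++ ((x , y) ∷ ps) = cong (λ z → x ∷ y ∷ z) (flatten-++ ps)

module Cycles where

  open PowerSeries
  open Counting
  open import Function using (case_of_)
  open import Data.Bool using (Bool; true; false; _∧_; not)
  import Data.Bool.Properties as Boolₚ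
  open import Data.Bool.ListAction using (all)
  open import Data.Nat using (zero; suc; _+_)
  import Data.Nat.Properties as ℕₚ
  open import Data.List using (filterᵇ)
  open import Data.Product as Product using (_×_; proj₁; proj₂; swap)
  open import Data.Sum using (inj₁; inj₂)
  open import Relation.Binary.PropositionalEquality
  open ≡-Reasoning

  module _ (F : FiniteField) where

    geodesicCycle : ∀ {ms} → List (Vtx F ms) → Bool
    geodesicCycle s = isGeodesic F (cycleExt F s)

    closedWalk : (G : Digraph F) → List (Digraph.V G) → Bool
    closedWalk G s = allPairs (Digraph.edge G) (closeUp F s)

    -- the opposition graph of B(V₁, …, V_r): the disjoint union of the X₀(Vᵢ)
    oppositionGraph : List ℕ → Digraph F
    oppositionGraph ms = record { V = Vtx F ms ; vs = verts F ms ; edge = oppJ F }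

    private
      all-true : ∀ {A : Set} (p : A → Bool) → (∀ x → p x ≡ true) → ∀ xs → all p xs ≡ true
      all-true p e []       = refl
      all-true p e (x ∷ xs) = cong₂ _∧_ (e x) (all-true p e xs)

    eqVtx-refl : ∀ {ms} (x : Vtx F ms) → eqVtx F x x ≡ true
    eqVtx-refl {m ∷ ms} (inj₁ W) = cong₂ _∧_ W⊆W W⊆W
      where
      W⊆W : _⊆?_ F (mem F W) (mem F W) ≡ true
      W⊆W = all-true _ (λ v → Boolₚ.∨-inverseˡ (mem F W v)) (allVects F m)
    eqVtx-refl {m ∷ ms} (inj₂ x) = eqVtx-refl x

    geodesicCycle-singleton : ∀ {ms} (x : Vtx F ms) → geodesicCycle (x ∷ []) ≡ false
    geodesicCycle-singleton x rewrite eqVtx-refl x = refl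

    geodesicCycle-inj₁ : ∀ {n ms ms'} (s : List (Tab F n)) → geodesicCycle {n ∷ ms} (map inj₁ s) ≡ geodesicCycle {n ∷ ms'} (map inj₁ s)
    geodesicCycle-inj₁ {n} {ms} {ms'} s
      rewrite cycleExt-map F (inj₁ {B = Vtx F ms}) s | cycleExt-map F (inj₁ {B = Vtx F ms'}) s
            | allPairs-map (pathStep F {n ∷ ms}) inj₁ (cycleExt F s) | allPairs-map (pathStep F {n ∷ ms'}) inj₁ (cycleExt F s)
            | allTriples-map (oppLink F {n ∷ ms}) inj₁ (cycleExt F s) | allTriples-map (oppLink F {n ∷ ms'}) inj₁ (cycleExt F s) = refl

    geodesicCycle-inj₂ : ∀ {n ms} (s : List (Vtx F ms)) → geodesicCycle {n ∷ ms} (map inj₂ s) ≡ geodesicCycle s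
    geodesicCycle-inj₂ {n} {ms} s
      rewrite cycleExt-map F (inj₂ {A = Tab F n}) s
            | allPairs-map (pathStep F {n ∷ ms}) inj₂ (cycleExt F s)
            | allTriples-map (oppLink F {n ∷ ms}) inj₂ (cycleExt F s) = refl

    Ngeo-singleton : ∀ n l → Ngeo F (n ∷ []) l ≡ count (geodesicCycle {n ∷ []} ∘ map inj₁) (listsOf (vertsB F n) l)
    Ngeo-singleton n l = trans (cong (count geodesicCycle ∘ (λ xs → listsOf xs l)) (Listₚ.++-identityʳ (map inj₁ (vertsB F n))))
                               (count-listsOf-map geodesicCycle inj₁ (vertsB F n) l)

    Nc-⊗-comm : ∀ G H l → Nc F (_⊗_ F G H) l ≡ Nc F (_⊗_ F H G) l
    Nc-⊗-comm G H l = trans (count-listsOf-swap (closedWalk (_⊗_ F G H)) (Digraph.vs G) (Digraph.vs H) l)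
      (count-cong swapped (listsOf (pairsOf (Digraph.vs H) (Digraph.vs G)) l))
      where
      swapped : ∀ q → closedWalk (_⊗_ F G H) (map swap q) ≡ closedWalk (_⊗_ F H G) q
      swapped q rewrite closeUp-map F swap q | allPairs-map (Digraph.edge (_⊗_ F G H)) swap (closeUp F q) =
        allPairs-cong (λ x y → Boolₚ.∧-comm (Digraph.edge G (proj₂ x) (proj₂ y)) (Digraph.edge H (proj₁ x) (proj₁ y))) (closeUp F q)

    module _ {X : Set} (xs : List X) (p : X → Bool) (P : List X → Bool) (G₁ G₂ : Digraph F)
             (ι : Digraph.V G₁ → X) (κ : Digraph.V G₂ → X)
             (filter-p : filterᵇ p xs ≡ map ι (Digraph.vs G₁)) (filter-¬p : filterᵇ (not ∘ p) xs ≡ map κ (Digraph.vs G₂))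
             (P-walk : ∀ q qs → P (flatten (map (Product.map ι κ) (q ∷ qs))) ≡ closedWalk (_⊗_ F G₁ G₂) (q ∷ qs)) where

      private
        alternatingP : List X → Bool
        alternatingP s = alternating p (not ∘ p) s ∧ P s

        pairP : X × X → Bool
        pairP xy = p (proj₁ xy) ∧ not (p (proj₂ xy))

      count-alternating-even : ∀ m → count alternatingP (listsOf xs (twice (suc m))) ≡ Nc F (_⊗_ F G₁ G₂) (suc m)
      count-alternating-even m = begin
        count alternatingP (listsOf xs (twice (suc m)))
          ≡⟨ count-listsOf-twice alternatingP xs (suc m) ⟩
        count (alternatingP ∘ flatten) (listsOf (pairsOf xs xs) (suc m))
          ≡⟨ count-cong (λ ps → cong (_∧ P (flatten ps)) (alternating-flatten p (not ∘ p) ps)) (listsOf (pairsOf xs xs) (suc m)) ⟩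
        count (λ ps → all pairP ps ∧ P (flatten ps)) (listsOf (pairsOf xs xs) (suc m))
          ≡⟨ count-listsOf-all pairP (P ∘ flatten) (pairsOf xs xs) (suc m) ⟩
        count (P ∘ flatten) (listsOf (filterᵇ pairP (pairsOf xs xs)) (suc m))
          ≡⟨ cong (λ ys → count (P ∘ flatten) (listsOf ys (suc m))) alphabet ⟩
        count (P ∘ flatten) (listsOf (map (Product.map ι κ) (pairsOf (Digraph.vs G₁) (Digraph.vs G₂))) (suc m))
          ≡⟨ count-listsOf-map (P ∘ flatten) (Product.map ι κ) (pairsOf (Digraph.vs G₁) (Digraph.vs G₂)) (suc m) ⟩
        count (P ∘ flatten ∘ map (Product.map ι κ)) (listsOf (pairsOf (Digraph.vs G₁) (Digraph.vs G₂)) (suc m))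
          ≡⟨ count-listsOf-cong (pairsOf (Digraph.vs G₁) (Digraph.vs G₂)) (suc m) (λ { (q ∷ qs) _ → P-walk q qs }) ⟩
        Nc F (_⊗_ F G₁ G₂) (suc m) ∎
        where
        alphabet : filterᵇ pairP (pairsOf xs xs) ≡ map (Product.map ι κ) (pairsOf (Digraph.vs G₁) (Digraph.vs G₂))
        alphabet = begin
          filterᵇ pairP (pairsOf xs xs)                                   ≡⟨ filterᵇ-pairsOf p (not ∘ p) xs xs ⟩
          pairsOf (filterᵇ p xs) (filterᵇ (not ∘ p) xs)                   ≡⟨ cong₂ pairsOf filter-p filter-¬p ⟩
          pairsOf (map ι (Digraph.vs G₁)) (map κ (Digraph.vs G₂))         ≡⟨ pairsOf-map ι κ (Digraph.vs G₁) (Digraph.vs G₂) ⟩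
          map (Product.map ι κ) (pairsOf (Digraph.vs G₁) (Digraph.vs G₂)) ∎

      count-alternating : ∀ l → count alternatingP (listsOf xs (suc l)) ≡ sqN (Nc F (_⊗_ F G₁ G₂)) (suc l)
      count-alternating l with parity (suc l)
      ... | zero  , inj₁ ()
      ... | suc m , inj₁ eq = begin
        count alternatingP (listsOf xs (suc l))          ≡⟨ cong (count alternatingP ∘ listsOf xs) eq ⟩
        count alternatingP (listsOf xs (twice (suc m)))  ≡⟨ count-alternating-even m ⟩
        Nc F (_⊗_ F G₁ G₂) (suc m)                       ≡⟨ sym (sqN-twice (Nc F (_⊗_ F G₁ G₂)) (suc m)) ⟩
        sqN (Nc F (_⊗_ F G₁ G₂)) (twice (suc m))         ≡⟨ cong (sqN (Nc F (_⊗_ F G₁ G₂))) (sym eq) ⟩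
        sqN (Nc F (_⊗_ F G₁ G₂)) (suc l)                 ∎
      ... | k , inj₂ eq = begin
        count alternatingP (listsOf xs (suc l))
          ≡⟨ count-listsOf-cong xs (suc l) (λ s len → cong (_∧ P s) (alternating-odd p (not ∘ p) k s (trans len eq))) ⟩
        count (λ _ → false) (listsOf xs (suc l))   ≡⟨ count-none (λ _ → refl) (listsOf xs (suc l)) ⟩
        0                                          ≡⟨ sym (sqN-suc-twice (Nc F (_⊗_ F G₁ G₂)) k) ⟩
        sqN (Nc F (_⊗_ F G₁ G₂)) (suc (twice k))   ≡⟨ cong (sqN (Nc F (_⊗_ F G₁ G₂))) (sym eq) ⟩
        sqN (Nc F (_⊗_ F G₁ G₂)) (suc l)           ∎

  module Join (F : FiniteField) (n : ℕ) (ns : List ℕ) where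

    X : Set
    X = Vtx F (n ∷ ns)

    oppLink-isInj₁ : ∀ (x y z : X) → oppLink F x y z ≡ true → isInj₁ x ≡ isInj₁ z
    oppLink-isInj₁ (inj₁ _) (inj₁ _) (inj₁ _) _ = refl
    oppLink-isInj₁ (inj₁ _) (inj₂ _) (inj₁ _) _ = refl
    oppLink-isInj₁ (inj₂ _) (inj₁ _) (inj₂ _) _ = refl
    oppLink-isInj₁ (inj₂ _) (inj₂ _) (inj₂ _) _ = refl
    oppLink-isInj₁ (inj₁ _) (inj₁ _) (inj₂ _) ()
    oppLink-isInj₁ (inj₁ _) (inj₂ _) (inj₂ _) ()
    oppLink-isInj₁ (inj₂ _) (inj₁ _) (inj₁ _) ()
    oppLink-isInj₁ (inj₂ _) (inj₂ _) (inj₁ _) ()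

    geodesicCycle-alternates : ∀ (x y : X) s → geodesicCycle F (x ∷ y ∷ s) ≡ true →
      Alternates isInj₁ (isInj₁ x) (isInj₁ y) (cycleExt F (x ∷ y ∷ s))
    geodesicCycle-alternates x y s geo = allTriples-alternates oppLink-isInj₁ x y (s ++ x ∷ y ∷ [])
      (∧≡true⇒ʳ (allPairs (pathStep F) (cycleExt F (x ∷ y ∷ s))) geo)

    -- junk on lists of length < 2, which are never geodesic cycles
    firstInV₁ secondInV₁ : List X → Bool
    firstInV₁ []      = false
    firstInV₁ (x ∷ _) = isInj₁ x
    secondInV₁ (_ ∷ y ∷ _) = isInj₁ y
    secondInV₁ _           = false

    private
      G : List X → Bool
      G = geodesicCycle F

    -- Along a geodesic cycle the factor alternates with period two, so the factors of the
    -- first two vertices decide which of four classes the cycle belongs to.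
    sides-all : ∀ (g : Bool → Bool) x t →
      g (firstInV₁ (x ∷ t)) ∧ (g (secondInV₁ (x ∷ t)) ∧ G (x ∷ t)) ≡ all (g ∘ isInj₁) (x ∷ t) ∧ G (x ∷ t)
    sides-all g x t = trans (sym (Boolₚ.∧-assoc (g (isInj₁ x)) _ _)) (∧-congʳ-when (G (x ∷ t)) (classify t))
      where
      classify : ∀ t → G (x ∷ t) ≡ true → g (isInj₁ x) ∧ g (secondInV₁ (x ∷ t)) ≡ all (g ∘ isInj₁) (x ∷ t)
      classify []      geo = case trans (sym geo) (geodesicCycle-singleton F x) of λ ()
      classify (y ∷ r) geo = sym (all-Alternates g x y r (Alternates-++ˡ (x ∷ y ∷ r) (geodesicCycle-alternates x y r geo)))

    sides-alternating : ∀ (g : Bool → Bool) x t →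
      g (firstInV₁ (x ∷ t)) ∧ (not (g (secondInV₁ (x ∷ t))) ∧ G (x ∷ t)) ≡ alternating (g ∘ isInj₁) (not ∘ g ∘ isInj₁) (x ∷ t) ∧ G (x ∷ t)
    sides-alternating g x t = trans (sym (Boolₚ.∧-assoc (g (isInj₁ x)) _ _)) (∧-congʳ-when (G (x ∷ t)) (classify t))
      where
      classify : ∀ t → G (x ∷ t) ≡ true → g (isInj₁ x) ∧ not (g (secondInV₁ (x ∷ t))) ≡ alternating (g ∘ isInj₁) (not ∘ g ∘ isInj₁) (x ∷ t)
      classify []      geo = case trans (sym geo) (geodesicCycle-singleton F x) of λ ()
      classify (y ∷ r) geo = sym (alternating-Alternates g x y r (geodesicCycle-alternates x y r geo))

    private
      geodesicCycle-flatten : ∀ {A B : Set} (ι : A → X) (κ : B → X) →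
        (∀ a b → pathStep F (ι a) (κ b) ≡ true) → (∀ b a → pathStep F (κ b) (ι a) ≡ true) → ∀ q qs →
        G (flatten (map (Product.map ι κ) (q ∷ qs))) ≡
          allPairs (λ p p' → oppLink F (ι (proj₁ p)) (κ (proj₂ p)) (ι (proj₁ p')) ∧ oppLink F (κ (proj₂ p)) (ι (proj₁ p')) (κ (proj₂ p')))
                   (closeUp F (q ∷ qs))
      geodesicCycle-flatten ι κ step₁ step₂ q qs = begin
        isGeodesic F (cycleExt F (flatten (map ικ (q ∷ qs))))   ≡⟨ cong (isGeodesic F) (cycleExt-flatten F (ικ q) (map ικ qs)) ⟩
        isGeodesic F (flatten (closeUp F (map ικ (q ∷ qs))))     ≡⟨ cong (isGeodesic F ∘ flatten) (closeUp-map F ικ (q ∷ qs)) ⟩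
        isGeodesic F (flatten (map ικ (closeUp F (q ∷ qs))))     ≡⟨ cong₂ _∧_ (allPairs-flatten step₁ step₂ (closeUp F (q ∷ qs)))
                                                                            (allTriples-flatten (oppLink F) (closeUp F (q ∷ qs))) ⟩
        true ∧ allPairs E (closeUp F (q ∷ qs))                    ∎
        where
        ικ = Product.map ι κ
        E = λ p p' → oppLink F (ι (proj₁ p)) (κ (proj₂ p)) (ι (proj₁ p')) ∧ oppLink F (κ (proj₂ p)) (ι (proj₁ p')) (κ (proj₂ p'))

    walk-first-rest : ∀ q qs → G (flatten (map (Product.map inj₁ inj₂) (q ∷ qs))) ≡ closedWalk F (_⊗_ F (X0 F n) (oppositionGraph F ns)) (q ∷ qs)
    walk-first-rest = geodesicCycle-flatten inj₁ inj₂ (λ _ _ → refl) (λ _ _ → refl)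

    walk-rest-first : ∀ q qs → G (flatten (map (Product.map inj₂ inj₁) (q ∷ qs))) ≡ closedWalk F (_⊗_ F (oppositionGraph F ns) (X0 F n)) (q ∷ qs)
    walk-rest-first = geodesicCycle-flatten inj₂ inj₁ (λ _ _ → refl) (λ _ _ → refl)

    private
      V₁ = vertsB F n
      V₂ = verts F ns
      Vs = verts F (n ∷ ns)

    count-first : ∀ l → count (λ s → all isInj₁ s ∧ G s) (listsOf Vs l) ≡ Ngeo F (n ∷ []) l
    count-first l = begin
      count (λ s → all isInj₁ s ∧ G s) (listsOf Vs l)     ≡⟨ count-listsOf-all isInj₁ G Vs l ⟩
      count G (listsOf (filterᵇ isInj₁ Vs) l)             ≡⟨ cong (count G ∘ (λ xs → listsOf xs l)) (filterᵇ-inj₁ V₁ V₂ (λ _ → refl) (λ _ → refl)) ⟩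
      count G (listsOf (map inj₁ V₁) l)                    ≡⟨ count-listsOf-map G inj₁ V₁ l ⟩
      count (G ∘ map inj₁) (listsOf V₁ l)                  ≡⟨ count-cong (geodesicCycle-inj₁ F) (listsOf V₁ l) ⟩
      count (geodesicCycle F {n ∷ []} ∘ map inj₁) (listsOf V₁ l) ≡⟨ sym (Ngeo-singleton F n l) ⟩
      Ngeo F (n ∷ []) l                                    ∎

    count-rest : ∀ l → count (λ s → all (not ∘ isInj₁) s ∧ G s) (listsOf Vs l) ≡ Ngeo F ns l
    count-rest l = begin
      count (λ s → all (not ∘ isInj₁) s ∧ G s) (listsOf Vs l) ≡⟨ count-listsOf-all (not ∘ isInj₁) G Vs l ⟩
      count G (listsOf (filterᵇ (not ∘ isInj₁) Vs) l)     ≡⟨ cong (count G ∘ (λ xs → listsOf xs l)) (filterᵇ-inj₂ V₁ V₂ (λ _ → refl) (λ _ → refl)) ⟩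
      count G (listsOf (map inj₂ V₂) l)                    ≡⟨ count-listsOf-map G inj₂ V₂ l ⟩
      count (G ∘ map inj₂) (listsOf V₂ l)                  ≡⟨ count-cong (geodesicCycle-inj₂ F) (listsOf V₂ l) ⟩
      Ngeo F ns l                                          ∎

    count-first-rest : ∀ l → count (λ s → alternating isInj₁ (not ∘ isInj₁) s ∧ G s) (listsOf Vs (suc l))
                             ≡ sqN (Nc F (_⊗_ F (X0 F n) (oppositionGraph F ns))) (suc l)
    count-first-rest = count-alternating F Vs isInj₁ G (X0 F n) (oppositionGraph F ns) inj₁ inj₂
      (filterᵇ-inj₁ V₁ V₂ (λ _ → refl) (λ _ → refl)) (filterᵇ-inj₂ V₁ V₂ (λ _ → refl) (λ _ → refl)) walk-first-rest

    count-rest-first : ∀ l → count (λ s → alternating (not ∘ isInj₁) (not ∘ not ∘ isInj₁) s ∧ G s) (listsOf Vs (suc l))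
                             ≡ sqN (Nc F (_⊗_ F (X0 F n) (oppositionGraph F ns))) (suc l)
    count-rest-first l = trans
      (count-alternating F Vs (not ∘ isInj₁) G (oppositionGraph F ns) (X0 F n) inj₂ inj₁
        (filterᵇ-inj₂ V₁ V₂ (λ _ → refl) (λ _ → refl)) (filterᵇ-inj₁ V₁ V₂ (λ _ → refl) (λ _ → refl)) walk-rest-first l)
      (sqN-cong (Nc-⊗-comm F (oppositionGraph F ns) (X0 F n)) (suc l))

    Ngeo-∷ : ∀ l → Ngeo F (n ∷ ns) (suc l) ≡
      Ngeo F (n ∷ []) (suc l) + Ngeo F ns (suc l) + doubledSqN (Nc F (_⊗_ F (X0 F n) (oppositionGraph F ns))) (suc l)
    Ngeo-∷ l = begin
      count G L
        ≡⟨ count-split secondInV₁ G L ⟩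
      count (λ s → secondInV₁ s ∧ G s) L + count (λ s → not (secondInV₁ s) ∧ G s) L
        ≡⟨ cong₂ _+_ (count-split firstInV₁ _ L) (count-split firstInV₁ _ L) ⟩
      (count (λ s → firstInV₁ s ∧ (secondInV₁ s ∧ G s)) L + count (λ s → not (firstInV₁ s) ∧ (secondInV₁ s ∧ G s)) L)
        + (count (λ s → firstInV₁ s ∧ (not (secondInV₁ s) ∧ G s)) L + count (λ s → not (firstInV₁ s) ∧ (not (secondInV₁ s) ∧ G s)) L)
        ≡⟨ cong₂ _+_ (cong₂ _+_ first rest-first) (cong₂ _+_ first-rest rest) ⟩
      (Ngeo F (n ∷ []) (suc l) + M) + (M + Ngeo F ns (suc l))
        ≡⟨ solve 3 (λ a b m → (a :+ m) :+ (m :+ b) := a :+ b :+ (m :+ m)) refl (Ngeo F (n ∷ []) (suc l)) (Ngeo F ns (suc l)) M ⟩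
      Ngeo F (n ∷ []) (suc l) + Ngeo F ns (suc l) + (M + M) ∎
      where
      open import Data.Nat.Solver using (module +-*-Solver)
      open +-*-Solver
      L = listsOf Vs (suc l)
      M = sqN (Nc F (_⊗_ F (X0 F n) (oppositionGraph F ns))) (suc l)
      first : count (λ s → firstInV₁ s ∧ (secondInV₁ s ∧ G s)) L ≡ Ngeo F (n ∷ []) (suc l)
      first = trans (count-listsOf-cong Vs (suc l) (λ { (x ∷ t) _ → sides-all (λ b → b) x t })) (count-first (suc l))
      rest : count (λ s → not (firstInV₁ s) ∧ (not (secondInV₁ s) ∧ G s)) L ≡ Ngeo F ns (suc l)
      rest = trans (count-listsOf-cong Vs (suc l) (λ { (x ∷ t) _ → sides-all not x t })) (count-rest (suc l))
      first-rest : count (λ s → firstInV₁ s ∧ (not (secondInV₁ s) ∧ G s)) L ≡ M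
      first-rest = trans (count-listsOf-cong Vs (suc l) (λ { (x ∷ t) _ → sides-alternating (λ b → b) x t })) (count-first-rest l)
      rest-first : count (λ s → not (firstInV₁ s) ∧ (secondInV₁ s ∧ G s)) L ≡ M
      rest-first = trans (count-listsOf-cong Vs (suc l) (λ { (x ∷ t) _ →
          trans (cong (λ c → not (firstInV₁ (x ∷ t)) ∧ (c ∧ G (x ∷ t))) (sym (Boolₚ.not-involutive (secondInV₁ (x ∷ t)))))
                (sides-alternating not x t) }))
        (count-rest-first l)

  module Opposition (F : FiniteField) (G : Digraph F) (b : ℕ) (ms : List ℕ) where

    private
      H : Digraph F
      H = _⊗_ F G (oppositionGraph F (b ∷ ms))

      P : Set
      P = Digraph.V H

      inFirst₂ : P → Bool
      inFirst₂ p = isInj₁ (proj₂ p)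

      W = closedWalk F H
      U₁ = vertsB F b
      U₂ = verts F ms

      edge-inFirst₂ : ∀ p p' → Digraph.edge H p p' ≡ true → inFirst₂ p ≡ inFirst₂ p'
      edge-inFirst₂ (_ , inj₁ _) (_ , inj₁ _) _ = refl
      edge-inFirst₂ (_ , inj₂ _) (_ , inj₂ _) _ = refl
      edge-inFirst₂ (g , inj₁ _) (g' , inj₂ _) e = case trans (sym (Boolₚ.∧-zeroʳ (Digraph.edge G g g'))) e of λ ()
      edge-inFirst₂ (g , inj₂ _) (g' , inj₁ _) e = case trans (sym (Boolₚ.∧-zeroʳ (Digraph.edge G g g'))) e of λ ()

      starts₂ : List P → Bool
      starts₂ []      = false
      starts₂ (p ∷ _) = inFirst₂ p

      side : ∀ (g : Bool → Bool) p q → g (starts₂ (p ∷ q)) ∧ W (p ∷ q) ≡ all (g ∘ inFirst₂) (p ∷ q) ∧ W (p ∷ q)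
      side g p q = ∧-congʳ-when (W (p ∷ q)) λ w →
        sym (all-Alternates-const g p q (Alternates-++ˡ (p ∷ q) (allPairs-alternates edge-inFirst₂ p (q ++ p ∷ []) w)))

      count-side : ∀ (g : Bool → Bool) (K : Digraph F) (ι : Digraph.V K → Vtx F (b ∷ ms)) →
        filterᵇ (g ∘ isInj₁) (verts F (b ∷ ms)) ≡ map ι (Digraph.vs K) →
        (∀ q → W (map (Product.map₂ ι) q) ≡ closedWalk F (_⊗_ F G K) q) →
        ∀ l → count (λ q → all (g ∘ inFirst₂) q ∧ W q) (listsOf (Digraph.vs H) l) ≡ Nc F (_⊗_ F G K) l
      count-side g K ι filter-g walk l = begin
        count (λ q → all (g ∘ inFirst₂) q ∧ W q) (listsOf (Digraph.vs H) l)
          ≡⟨ count-listsOf-all (g ∘ inFirst₂) W (Digraph.vs H) l ⟩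
        count W (listsOf (filterᵇ (g ∘ inFirst₂) (Digraph.vs H)) l)
          ≡⟨ cong (count W ∘ (λ xs → listsOf xs l)) alphabet ⟩
        count W (listsOf (map (Product.map₂ ι) (pairsOf (Digraph.vs G) (Digraph.vs K))) l)
          ≡⟨ count-listsOf-map W (Product.map₂ ι) (pairsOf (Digraph.vs G) (Digraph.vs K)) l ⟩
        count (W ∘ map (Product.map₂ ι)) (listsOf (pairsOf (Digraph.vs G) (Digraph.vs K)) l)
          ≡⟨ count-cong walk (listsOf (pairsOf (Digraph.vs G) (Digraph.vs K)) l) ⟩
        Nc F (_⊗_ F G K) l ∎
        where
        alphabet : filterᵇ (g ∘ inFirst₂) (Digraph.vs H) ≡ map (Product.map₂ ι) (pairsOf (Digraph.vs G) (Digraph.vs K))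
        alphabet = begin
          filterᵇ (g ∘ inFirst₂) (Digraph.vs H)                            ≡⟨ filterᵇ-pairsOf (λ _ → true) (g ∘ isInj₁) (Digraph.vs G) (verts F (b ∷ ms)) ⟩
          pairsOf (filterᵇ (λ _ → true) (Digraph.vs G)) (filterᵇ (g ∘ isInj₁) (verts F (b ∷ ms)))
                                                                           ≡⟨ cong₂ pairsOf (filterᵇ-all (λ _ → refl) (Digraph.vs G)) filter-g ⟩
          pairsOf (Digraph.vs G) (map ι (Digraph.vs K))                    ≡⟨ pairsOf-mapʳ ι (Digraph.vs G) (Digraph.vs K) ⟩
          map (Product.map₂ ι) (pairsOf (Digraph.vs G) (Digraph.vs K))     ∎

      walk-inj : ∀ {K : Digraph F} (ι : Digraph.V K → Vtx F (b ∷ ms)) →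
        (∀ x y → oppJ F (ι x) (ι y) ≡ Digraph.edge K x y) → ∀ q → W (map (Product.map₂ ι) q) ≡ closedWalk F (_⊗_ F G K) q
      walk-inj {K} ι edge-ι q = begin
        allPairs (Digraph.edge H) (closeUp F (map (Product.map₂ ι) q))      ≡⟨ cong (allPairs (Digraph.edge H)) (closeUp-map F (Product.map₂ ι) q) ⟩
        allPairs (Digraph.edge H) (map (Product.map₂ ι) (closeUp F q))      ≡⟨ allPairs-map (Digraph.edge H) (Product.map₂ ι) (closeUp F q) ⟩
        allPairs (λ x y → Digraph.edge H (Product.map₂ ι x) (Product.map₂ ι y)) (closeUp F q)
                                                                             ≡⟨ allPairs-cong (λ x y → cong (Digraph.edge G (proj₁ x) (proj₁ y) ∧_) (edge-ι (proj₂ x) (proj₂ y))) (closeUp F q) ⟩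
        closedWalk F (_⊗_ F G K) q                                           ∎

    Nc-⊗-opposition-∷ : ∀ l → Nc F (_⊗_ F G (oppositionGraph F (b ∷ ms))) (suc l)
                              ≡ Nc F (_⊗_ F G (X0 F b)) (suc l) + Nc F (_⊗_ F G (oppositionGraph F ms)) (suc l)
    Nc-⊗-opposition-∷ l = begin
      count W L                                                    ≡⟨ count-split starts₂ W L ⟩
      count (λ q → starts₂ q ∧ W q) L + count (λ q → not (starts₂ q) ∧ W q) L
        ≡⟨ cong₂ _+_ (count-listsOf-cong (Digraph.vs H) (suc l) (λ { (p ∷ q) _ → side (λ x → x) p q }))
                     (count-listsOf-cong (Digraph.vs H) (suc l) (λ { (p ∷ q) _ → side not p q })) ⟩
      count (λ q → all inFirst₂ q ∧ W q) L + count (λ q → all (not ∘ inFirst₂) q ∧ W q) L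
        ≡⟨ cong₂ _+_ first rest ⟩
      Nc F (_⊗_ F G (X0 F b)) (suc l) + Nc F (_⊗_ F G (oppositionGraph F ms)) (suc l) ∎
      where
      L = listsOf (Digraph.vs H) (suc l)
      first : count (λ q → all inFirst₂ q ∧ W q) L ≡ Nc F (_⊗_ F G (X0 F b)) (suc l)
      first = count-side (λ x → x) (X0 F b) inj₁ (filterᵇ-inj₁ U₁ U₂ (λ _ → refl) (λ _ → refl))
                (walk-inj {X0 F b} inj₁ (λ _ _ → refl)) (suc l)
      rest : count (λ q → all (not ∘ inFirst₂) q ∧ W q) L ≡ Nc F (_⊗_ F G (oppositionGraph F ms)) (suc l)
      rest = count-side not (oppositionGraph F ms) inj₂ (filterᵇ-inj₂ U₁ U₂ (λ _ → refl) (λ _ → refl))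
               (walk-inj {oppositionGraph F ms} inj₂ (λ _ _ → refl)) (suc l)

  module _ (F : FiniteField) where

    Nc-⊗-opposition : ∀ G ms l → Nc F (_⊗_ F G (oppositionGraph F ms)) (suc l) ≡ sumAt (map (λ b → Nc F (_⊗_ F G (X0 F b))) ms) (suc l)
    Nc-⊗-opposition G []       l = cong (λ xs → count (closedWalk F (_⊗_ F G (oppositionGraph F []))) (listsOf xs (suc l))) (pairsOf-[] (Digraph.vs G))
    Nc-⊗-opposition G (b ∷ ms) l = trans (Opposition.Nc-⊗-opposition-∷ F G b ms l) (cong (Nc F (_⊗_ F G (X0 F b)) (suc l) +_) (Nc-⊗-opposition G ms l))

    pairCount : ℕ × ℕ → ℕ → ℕ
    pairCount (a , b) = doubledSqN (Nc F (_⊗_ F (X0 F a) (X0 F b)))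

    cycleCounts : List ℕ → List (ℕ → ℕ)
    cycleCounts ns = map (λ d → Ngeo F (d ∷ [])) ns ++ map pairCount (pairsLT ns)

    doubledSqN-opposition : ∀ a ms l → doubledSqN (Nc F (_⊗_ F (X0 F a) (oppositionGraph F ms))) (suc l) ≡ sumAt (map (pairCount ∘ (a ,_)) ms) (suc l)
    doubledSqN-opposition a ms l = begin
      T′ + T′                                         ≡⟨ cong (λ t → t + t) (trans (sqN-cong⁺ (Nc-⊗-opposition (X0 F a) ms) l) (sqN-sumAt Ns (suc l))) ⟩
      sumAt (map sqN Ns) (suc l) + sumAt (map sqN Ns) (suc l) ≡⟨ sym (sumAt-doubledSqN Ns (suc l)) ⟩
      sumAt (map doubledSqN Ns) (suc l)               ≡⟨ cong (λ fs → sumAt fs (suc l)) (sym (Listₚ.map-∘ ms)) ⟩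
      sumAt (map (pairCount ∘ (a ,_)) ms) (suc l)     ∎
      where
      Ns = map (λ b → Nc F (_⊗_ F (X0 F a) (X0 F b))) ms
      T′ = sqN (Nc F (_⊗_ F (X0 F a) (oppositionGraph F ms))) (suc l)

    sumAt-cycleCounts-∷ : ∀ a ms l → sumAt (cycleCounts (a ∷ ms)) l ≡
      Ngeo F (a ∷ []) l + (sumAt (map (λ d → Ngeo F (d ∷ [])) ms) l + (sumAt (map (pairCount ∘ (a ,_)) ms) l + sumAt (map pairCount (pairsLT ms)) l))
    sumAt-cycleCounts-∷ a ms l = cong (Ngeo F (a ∷ []) l +_) (begin
      sumAt (singles ++ map pairCount (map (a ,_) ms ++ pairsLT ms)) l             ≡⟨ sumAt-++ singles _ l ⟩
      sumAt singles l + sumAt (map pairCount (map (a ,_) ms ++ pairsLT ms)) l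
        ≡⟨ cong (λ fs → sumAt singles l + sumAt fs l) (Listₚ.map-++ pairCount (map (a ,_) ms) (pairsLT ms)) ⟩
      sumAt singles l + sumAt (map pairCount (map (a ,_) ms) ++ map pairCount (pairsLT ms)) l
                                                                                   ≡⟨ cong (sumAt singles l +_) (sumAt-++ (map pairCount (map (a ,_) ms)) _ l) ⟩
      sumAt singles l + (sumAt (map pairCount (map (a ,_) ms)) l + sumAt (map pairCount (pairsLT ms)) l)
                                                                                   ≡⟨ cong (λ fs → sumAt singles l + (sumAt fs l + sumAt (map pairCount (pairsLT ms)) l)) (sym (Listₚ.map-∘ ms)) ⟩
      sumAt singles l + (sumAt (map (pairCount ∘ (a ,_)) ms) l + sumAt (map pairCount (pairsLT ms)) l) ∎)
      where
      singles = map (λ d → Ngeo F (d ∷ [])) ms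

    Ngeo-cycleCounts : ∀ ns l → Ngeo F ns (suc l) ≡ sumAt (cycleCounts ns) (suc l)
    Ngeo-cycleCounts []       l = refl
    Ngeo-cycleCounts (a ∷ ms) l = begin
      Ngeo F (a ∷ ms) (suc l)                                                     ≡⟨ Join.Ngeo-∷ F a ms l ⟩
      A + Ngeo F ms (suc l) + doubledSqN (Nc F (_⊗_ F (X0 F a) (oppositionGraph F ms))) (suc l)
                                                                                  ≡⟨ cong₂ (λ u v → A + u + v)
                                                                                       (trans (Ngeo-cycleCounts ms l) (sumAt-++ singles pairs (suc l)))
                                                                                       (doubledSqN-opposition a ms l) ⟩
      A + (S + P) + Q
        ≡⟨ solve 4 (λ a s p q → a :+ (s :+ p) :+ q := a :+ (s :+ (q :+ p))) refl A S P Q ⟩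
      A + (S + (Q + P))                                                           ≡⟨ sym (sumAt-cycleCounts-∷ a ms (suc l)) ⟩
      sumAt (cycleCounts (a ∷ ms)) (suc l)                                        ∎
      where
      open import Data.Nat.Solver using (module +-*-Solver)
      open +-*-Solver
      singles = map (λ d → Ngeo F (d ∷ [])) ms
      pairs = map pairCount (pairsLT ms)
      A = Ngeo F (a ∷ []) (suc l)
      S = sumAt singles (suc l)
      P = sumAt pairs (suc l)
      Q = sumAt (map (pairCount ∘ (a ,_)) ms) (suc l)

open PowerSeries
open Cycles

corollary1p3p10 : (F : FiniteField) (ns : List ℕ) (n : ℕ) →
    ZB F ns n
      ≡ (prodS (map (λ d → ZB F (d ∷ [])) ns)
          *S prodS (map (λ { (a , b) → sqS (Zc F (_⊗_ F (X0 F a) (X0 F b))) }) (pairsLT ns))) n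
corollary1p3p10 F ns n = begin
  ZB F ns n                                                       ≡⟨ zetaFrom-cong (Ngeo-cycleCounts F ns) n ⟩
  zetaFrom (sumAt (singles ++ pairs)) n                           ≡⟨ zetaFrom-sumAt (singles ++ pairs) n ⟩
  prodS (map zetaFrom (singles ++ pairs)) n                       ≡⟨ cong (λ fs → prodS fs n) (Listₚ.map-++ zetaFrom singles pairs) ⟩
  prodS (map zetaFrom singles ++ map zetaFrom pairs) n            ≡⟨ prodS-++ (map zetaFrom singles) (map zetaFrom pairs) n ⟩
  (prodS (map zetaFrom singles) *S prodS (map zetaFrom pairs)) n
    ≡⟨ *S-cong (prodS-map-zetaFrom (λ d → Ngeo F (d ∷ [])) (λ _ _ → refl) ns)
               (prodS-map-zetaFrom (pairCount F) (λ { (a , b) → zetaFrom-doubledSqN (Nc F (_⊗_ F (X0 F a) (X0 F b))) }) (pairsLT ns)) n ⟩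
  (prodS (map (λ d → ZB F (d ∷ [])) ns)
    *S prodS (map (λ { (a , b) → sqS (Zc F (_⊗_ F (X0 F a) (X0 F b))) }) (pairsLT ns))) n ∎
  where
  open ≡-Reasoning
  singles = map (λ d → Ngeo F (d ∷ [])) ns
  pairs = map (pairCount F) (pairsLT ns)
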